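{- For every $n\ge 1$, the number of inversion sequences $e\in I_n(011,201)$ whose bounce equals the number of entries equal to $0$ (equivalently, whose set of values is exactly $\{0,1,\dots,M\}$ where $M$ is the maximum of $e$) equals the number of rushed Dyck paths of semilength $n+1$; i.e. these inversion sequences are enumerated by the sequence A287709 of the OEIS.
   Context: An inversion sequence of length $n$ is an integer sequence $e=(e_1,\dots,e_n)$ with $0\le e_j\le j-1$. $e$ contains a pattern $f=(f_1,\dots,f_m)$ if there are indices $i_1<\dots<i_m$ with $e_{i_a}<e_{i_b}$ iff $f_a<f_b$ and $e_{i_a}=e_{i_b}$ iff $f_a=f_b$ for all $a,b$; otherwise it avoids $f$. $I_n(011,201)$ is the set of inversion sequences of length $n$ avoiding $011$ and $201$. The bounce of $e$ is $n-M$ where $M=\max_j e_j$. A Dyck path of semilength $m$ is a lattice path from $(0,0)$ to $(2m,0)$ with steps $(1,1)$, $(1,-1)$ never going below the $x$-axis; it is rushed if it starts with $h\ge1$ up-steps and afterwards never visits altitude $h$ again. -}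

module Defs where

open import Data.Nat using (ℕ; zero; suc; _∸_; _⊔_; _<ᵇ_; _≡ᵇ_)
open import Data.Bool using (Bool; true; false; _∧_; _∨_; not; if_then_else_)
open import Data.List using (List; []; _∷_; _++_; map; concatMap; length; filter; foldr; upTo; take; drop; zip; sum; applyUpTo)
open import Data.Product using (_,_; _×_)
open import Data.Bool.ListAction using (all; any)

_==_ : Bool → Bool → Bool
true  == b = b
false == b = not b

allLists : ℕ → ℕ → List (List ℕ)
allLists zero    b = [] ∷ []
allLists (suc n) b = concatMap (λ x → map (x ∷_) (allLists n b)) (upTo b)

allBoolLists : ℕ → List (List Bool)
allBoolLists zero    = [] ∷ []
allBoolLists (suc n) = concatMap (λ x → map (x ∷_) (allBoolLists n)) (true ∷ false ∷ [])

subseqs : {A : Set} → List A → List (List A)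
subseqs []       = [] ∷ []
subseqs (x ∷ xs) = map (x ∷_) (subseqs xs) ++ subseqs xs

-- e = (e₁,…,eₙ) with 0 ≤ eⱼ ≤ j-1; the argument j is the (1-based) index of the head
isInvFrom : ℕ → List ℕ → Bool
isInvFrom j []       = true
isInvFrom j (x ∷ xs) = (x <ᵇ j) ∧ isInvFrom (suc j) xs

isInvSeq : List ℕ → Bool
isInvSeq = isInvFrom 1

invSeqs : ℕ → List (List ℕ)
invSeqs n = filter (λ e → Data.Bool._≟_ (isInvSeq e) true) (allLists n n)
  where import Data.Bool

sameRel : ℕ → ℕ → ℕ → ℕ → Bool
sameRel x y u v = ((x <ᵇ y) == (u <ᵇ v)) ∧ ((x ≡ᵇ y) == (u ≡ᵇ v))

orderIso : List ℕ → List ℕ → Bool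
orderIso s f = (length s ≡ᵇ length f) ∧
  all (λ { (x , u) → all (λ { (y , v) → sameRel x y u v }) (zip s f) }) (zip s f)

contains : List ℕ → List ℕ → Bool
contains e f = any (λ s → orderIso s f) (subseqs e)

avoids : List ℕ → List ℕ → Bool
avoids e f = not (contains e f)

maxL : List ℕ → ℕ
maxL = foldr _⊔_ 0

bounce : List ℕ → ℕ
bounce e = length e ∸ maxL e

zeros : List ℕ → ℕ
zeros e = length (filter (λ x → Data.Nat._≟_ x 0) e)
  where import Data.Nat

good : List ℕ → Bool
good e = avoids e (0 ∷ 1 ∷ 1 ∷ []) ∧ avoids e (2 ∷ 0 ∷ 1 ∷ []) ∧ (bounce e ≡ᵇ zeros e)

countGood : ℕ → ℕ
countGood n = length (filter (λ e → Data.Bool._≟_ (good e) true) (invSeqs n))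
  where import Data.Bool

-- Dyck paths: true = up-step (1,1), false = down-step (1,-1)

dyckFrom : ℕ → List Bool → Bool
dyckFrom h       []            = h ≡ᵇ 0
dyckFrom h       (true  ∷ p)   = dyckFrom (suc h) p
dyckFrom zero    (false ∷ p)   = false
dyckFrom (suc h) (false ∷ p)   = dyckFrom h p

isDyck : List Bool → Bool
isDyck = dyckFrom 0

dyckPaths : ℕ → List (List Bool)
dyckPaths m = filter (λ p → Data.Bool._≟_ (isDyck p) true) (allBoolLists (m Data.Nat.+ m))
  where import Data.Bool; import Data.Nat

altsFrom : ℕ → List Bool → List ℕ
altsFrom h []          = []
altsFrom h (true  ∷ p) = suc h ∷ altsFrom (suc h) p
altsFrom h (false ∷ p) = (h ∸ 1) ∷ altsFrom (h ∸ 1) p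

-- rushed: for some h ≥ 1 the path starts with h up-steps and, after those
-- h steps, never visits altitude h again
rushed : List Bool → Bool
rushed p = any (λ h → (length (take h p) ≡ᵇ h) ∧ all (λ b → b) (take h p)
                      ∧ all (λ a → not (a ≡ᵇ h)) (drop h (altsFrom 0 p)))
               (applyUpTo suc (length p))

countRushed : ℕ → ℕ
countRushed m = length (filter (λ p → Data.Bool._≟_ (rushed p) true) (dyckPaths m))
  where import Data.Bool

-- Reading a sequence of I_n(011,201) from left to right, its nonzero values are
-- distinct (a repeated one forms a 011 with the initial 0), and after a prefix P
-- the positive values that may follow without creating a 201 are those above
-- max P together with a decreasing stack of pending values, skipped over by
-- earlier records and not yet cut off by a smaller entry. The bounce equals the
-- number of zeros exactly when the values used are 0, …, max e, so the number of
-- good completions of P by r entries vanishes unless every value below max P is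
-- used or pending, and then only depends on D = |P| − max P and on the number k
-- of pending values; it satisfies
--   Q (r+1) D k = Q r (D+1) (k−1) + Σ_{i<D} Q r (D−i) (k+i):
-- the next entry is either the top of the stack (or 0 if the stack is empty),
-- or the new maximum max P + 1 + i. This recurrence is solved by counts of
-- walks below a ceiling that an initial run of up-steps drags along, and the
-- same count arises from a rushed Dyck path of semilength n + 1, cut after its
-- initial run of h up-steps, as a walk that stays below altitude h.

module Submission where

open import Defs
open import Data.Nat using (ℕ; zero; suc; _+_; _∸_; _⊔_; _<_; _≤_; _<ᵇ_; _≡ᵇ_; z≤n; s≤s; z<s; s<s)
open import Data.Nat.Properties
open import Data.Nat.ListAction using (sum)
open import Data.Nat.Tactic.RingSolver using (solve-∀)
open import Data.Bool using (Bool; true; false; _∧_; _∨_; not; if_then_else_; T)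
open import Data.Bool.Properties
  using (T-≡; ∧-assoc; ∧-idem; ∧-identityʳ; ∧-zeroʳ; ∨-assoc; ∨-identityʳ; ∨-zeroʳ; not-involutive;
         ∧-commutativeMonoid; ∨-commutativeMonoid)
open import Data.Bool.ListAction using (any; all)
open import Data.List using (List; []; _∷_; _++_; _∷ʳ_; map; concatMap; filter; length; take; drop; applyUpTo; upTo)
open import Data.List.Properties using (++-assoc; ++-identityʳ; length-++; map-cong)
open import Data.Product using (_×_; _,_; proj₁; proj₂)
open import Data.Sum using (inj₁; inj₂)
open import Data.Unit using (⊤; tt)
open import Data.Empty using (⊥-elim)
open import Function using (_∘_; Equivalence)
open import Relation.Nullary using (¬_; yes; no)
open import Relation.Binary.Definitions using (tri<; tri≈; tri>)
open import Relation.Binary.PropositionalEquality using (_≡_; _≢_; refl; sym; trans; cong; cong₂; subst; subst₂; module ≡-Reasoning)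
open import Algebra.Bundles using (CommutativeMonoid)
import Data.Bool as Bool
import Algebra.Properties.CommutativeSemigroup as CommSemigroupProperties

open CommSemigroupProperties +-commutativeSemigroup
  using () renaming (interchange to +-interchange)
open CommSemigroupProperties (CommutativeMonoid.commutativeSemigroup ∧-commutativeMonoid)
  using () renaming (interchange to ∧-interchange)
open CommSemigroupProperties (CommutativeMonoid.commutativeSemigroup ∨-commutativeMonoid)
  using () renaming (interchange to ∨-interchange)

private variable
  A B : Set

count : (A → Bool) → List A → ℕ
count p []       = 0
count p (x ∷ xs) = (if p x then 1 else 0) + count p xs

length-filter≡count : (p : A → Bool) (xs : List A) →
  length (filter (λ x → Bool._≟_ (p x) true) xs) ≡ count p xs
length-filter≡count p []       = refl
length-filter≡count p (x ∷ xs) with p x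
... | true  = cong suc (length-filter≡count p xs)
... | false = length-filter≡count p xs

count-filter : (p q : A → Bool) (xs : List A) →
  count q (filter (λ x → Bool._≟_ (p x) true) xs) ≡ count (λ x → p x ∧ q x) xs
count-filter p q []       = refl
count-filter p q (x ∷ xs) with p x
... | true  = cong ((if q x then 1 else 0) +_) (count-filter p q xs)
... | false = count-filter p q xs

count-++ : (p : A → Bool) (xs ys : List A) → count p (xs ++ ys) ≡ count p xs + count p ys
count-++ p []       ys = refl
count-++ p (x ∷ xs) ys =
  trans (cong ((if p x then 1 else 0) +_) (count-++ p xs ys)) (sym (+-assoc (if p x then 1 else 0) _ _))

count-map : (p : B → Bool) (f : A → B) (xs : List A) → count p (map f xs) ≡ count (p ∘ f) xs
count-map p f []       = refl
count-map p f (x ∷ xs) = cong ((if p (f x) then 1 else 0) +_) (count-map p f xs)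

count-cong : {p q : A → Bool} (xs : List A) → (∀ x → p x ≡ q x) → count p xs ≡ count q xs
count-cong []       p≗q = refl
count-cong (x ∷ xs) p≗q = cong₂ (λ b n → (if b then 1 else 0) + n) (p≗q x) (count-cong xs p≗q)

count-false : (xs : List A) → count (λ _ → false) xs ≡ 0
count-false []       = refl
count-false (x ∷ xs) = count-false xs

count-∧ˡ : (b : Bool) (p : A → Bool) (xs : List A) →
  count (λ x → b ∧ p x) xs ≡ (if b then count p xs else 0)
count-∧ˡ true  p xs = refl
count-∧ˡ false p xs = count-false xs

sumTo : ℕ → (ℕ → ℕ) → ℕ
sumTo zero    f = 0
sumTo (suc n) f = f 0 + sumTo n (f ∘ suc)

syntax sumTo n (λ i → e) = ∑[ i < n ] e

∑-cong : ∀ n {f g : ℕ → ℕ} → (∀ i → i < n → f i ≡ g i) → sumTo n f ≡ sumTo n g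
∑-cong zero    f≗g = refl
∑-cong (suc n) f≗g = cong₂ _+_ (f≗g 0 z<s) (∑-cong n (λ i i<n → f≗g (suc i) (s<s i<n)))

∑-zero : ∀ n {f : ℕ → ℕ} → (∀ i → i < n → f i ≡ 0) → sumTo n f ≡ 0
∑-zero zero    f≗0 = refl
∑-zero (suc n) f≗0 = cong₂ _+_ (f≗0 0 z<s) (∑-zero n (λ i i<n → f≗0 (suc i) (s<s i<n)))

∑-+ : ∀ n (f g : ℕ → ℕ) → (∑[ i < n ] (f i + g i)) ≡ sumTo n f + sumTo n g
∑-+ zero    f g = refl
∑-+ (suc n) f g = trans (cong (f 0 + g 0 +_) (∑-+ n (f ∘ suc) (g ∘ suc))) (+-interchange (f 0) (g 0) _ _)

∑-split : ∀ m n (f : ℕ → ℕ) → sumTo (m + n) f ≡ sumTo m f + (∑[ i < n ] f (m + i))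
∑-split zero    n f = refl
∑-split (suc m) n f = trans (cong (f 0 +_) (∑-split m n (f ∘ suc))) (sym (+-assoc (f 0) _ _))

∑-single : ∀ n (f : ℕ → ℕ) j → j < n → (∀ i → i < n → i ≢ j → f i ≡ 0) → sumTo n f ≡ f j
∑-single (suc n) f zero    _         others =
  trans (cong (f 0 +_) (∑-zero n (λ i i<n → others (suc i) (s<s i<n) (λ ())))) (+-identityʳ _)
∑-single (suc n) f (suc j) (s≤s j<n) others =
  trans (cong (_+ sumTo n (f ∘ suc)) (others 0 z<s (λ ())))
        (∑-single n (f ∘ suc) j j<n (λ i i<n i≢j → others (suc i) (s<s i<n) (i≢j ∘ suc-injective)))

∑-if : ∀ n b (f : ℕ → ℕ) → (∑[ i < n ] (if b then f i else 0)) ≡ (if b then sumTo n f else 0)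
∑-if n true  f = refl
∑-if n false f = ∑-zero n (λ _ _ → refl)

sum-map-applyUpTo : ∀ n (g f : ℕ → ℕ) → sum (map g (applyUpTo f n)) ≡ sumTo n (g ∘ f)
sum-map-applyUpTo zero    g f = refl
sum-map-applyUpTo (suc n) g f = cong (g (f 0) +_) (sum-map-applyUpTo n g (f ∘ suc))

count-concatMap : (p : B → Bool) (f : A → List B) (xs : List A) →
  count p (concatMap f xs) ≡ sum (map (count p ∘ f) xs)
count-concatMap p f []       = refl
count-concatMap p f (x ∷ xs) =
  trans (count-++ p (f x) (concatMap f xs)) (cong (count p (f x) +_) (count-concatMap p f xs))

count-allLists : ∀ r b (p : List ℕ → Bool) →
  count p (allLists (suc r) b) ≡ (∑[ x < b ] count (p ∘ (x ∷_)) (allLists r b))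
count-allLists r b p = begin
  count p (allLists (suc r) b)
    ≡⟨ count-concatMap p (λ x → map (x ∷_) (allLists r b)) (upTo b) ⟩
  sum (map (λ x → count p (map (x ∷_) (allLists r b))) (upTo b))
    ≡⟨ cong sum (map-cong (λ x → count-map p (x ∷_) (allLists r b)) (upTo b)) ⟩
  sum (map (λ x → count (p ∘ (x ∷_)) (allLists r b)) (upTo b))
    ≡⟨ sum-map-applyUpTo b _ (λ x → x) ⟩
  (∑[ x < b ] count (p ∘ (x ∷_)) (allLists r b))
    ∎
  where open ≡-Reasoning

count-allBoolLists : ∀ L (p : List Bool → Bool) →
  count p (allBoolLists (suc L)) ≡ count (p ∘ (true ∷_)) (allBoolLists L) + count (p ∘ (false ∷_)) (allBoolLists L)
count-allBoolLists L p =
  trans (count-concatMap p (λ x → map (x ∷_) (allBoolLists L)) (true ∷ false ∷ []))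
        (cong₂ _+_ (count-map p (true ∷_) (allBoolLists L))
                   (trans (+-identityʳ (count p (map (false ∷_) (allBoolLists L)))) (count-map p (false ∷_) (allBoolLists L))))

T⇒≡true : ∀ {b} → T b → b ≡ true
T⇒≡true = Equivalence.to T-≡

¬T⇒≡false : ∀ {b} → ¬ T b → b ≡ false
¬T⇒≡false {true}  ¬t = ⊥-elim (¬t _)
¬T⇒≡false {false} _  = refl

≡true⇒T : ∀ {b} → b ≡ true → T b
≡true⇒T = Equivalence.from T-≡

<ᵇ-true : ∀ {m n} → m < n → (m <ᵇ n) ≡ true
<ᵇ-true = T⇒≡true ∘ <⇒<ᵇ

<ᵇ-false : ∀ {m n} → n ≤ m → (m <ᵇ n) ≡ false
<ᵇ-false {m} {n} n≤m = ¬T⇒≡false (λ t → <⇒≱ (<ᵇ⇒< m n t) n≤m)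

<ᵇ-sound : ∀ {m n} → (m <ᵇ n) ≡ true → m < n
<ᵇ-sound {m} {n} = <ᵇ⇒< m n ∘ ≡true⇒T

≡ᵇ-refl : ∀ n → (n ≡ᵇ n) ≡ true
≡ᵇ-refl n = T⇒≡true (≡⇒≡ᵇ n n refl)

≡ᵇ-false : ∀ {m n} → m ≢ n → (m ≡ᵇ n) ≡ false
≡ᵇ-false {m} {n} m≢n = ¬T⇒≡false (m≢n ∘ ≡ᵇ⇒≡ m n)

≡ᵇ-sound : ∀ {m n} → (m ≡ᵇ n) ≡ true → m ≡ n
≡ᵇ-sound {m} {n} = ≡ᵇ⇒≡ m n ∘ ≡true⇒T

n<ᵇn : ∀ n → (n <ᵇ n) ≡ false
n<ᵇn n = <ᵇ-false {n} {n} ≤-refl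

≡ᵇ-sym : ∀ m n → (m ≡ᵇ n) ≡ (n ≡ᵇ m)
≡ᵇ-sym zero    zero    = refl
≡ᵇ-sym zero    (suc n) = refl
≡ᵇ-sym (suc m) zero    = refl
≡ᵇ-sym (suc m) (suc n) = ≡ᵇ-sym m n

<ᵇ-flip : ∀ {m n} → (m ≡ᵇ n) ≡ false → (n <ᵇ m) ≡ not (m <ᵇ n)
<ᵇ-flip {m} {n} m≢ᵇn with <-cmp m n
... | tri< m<n _ _ rewrite <ᵇ-true m<n = <ᵇ-false (<⇒≤ m<n)
... | tri> _ _ n<m rewrite <ᵇ-true n<m | <ᵇ-false {m} {n} (<⇒≤ n<m) = refl
... | tri≈ _ refl _ rewrite ≡ᵇ-refl m with m≢ᵇn
...   | ()

+-cancelˡ-<ᵇ : ∀ k m n → (k + m <ᵇ k + n) ≡ (m <ᵇ n)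
+-cancelˡ-<ᵇ zero    m n = refl
+-cancelˡ-<ᵇ (suc k) m n = +-cancelˡ-<ᵇ k m n

+-cancelˡ-≡ᵇ : ∀ k m n → (k + m ≡ᵇ k + n) ≡ (m ≡ᵇ n)
+-cancelˡ-≡ᵇ zero    m n = refl
+-cancelˡ-≡ᵇ (suc k) m n = +-cancelˡ-≡ᵇ k m n

-- walks u a c counts lattice walks with u up-steps from altitude a down to 0
-- that stay within [0, a + c].
walks : ℕ → ℕ → ℕ → ℕ
walks zero    a       c       = 1
walks (suc u) zero    zero    = 0
walks (suc u) zero    (suc c) = walks u 1 c
walks (suc u) (suc a) zero    = walks (suc u) a 1
walks (suc u) (suc a) (suc c) = walks u (suc (suc a)) c + walks (suc u) a (suc (suc c))

-- rushWalks u a c: an initial run of up-steps carries the ceiling, c above the walk,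
-- along with it; after the first down-step the ceiling stays put.
rushWalks : ℕ → ℕ → ℕ → ℕ
rushWalks zero    a c = 1
rushWalks (suc u) a c = walks (suc u) a c + rushWalks u (suc a) c

-- Splitting by the number i of up-steps before the first down-step.
walks-by-first-descent : ∀ c u a →
  walks u (suc a) c ≡ (∑[ i < suc c ] (if i <ᵇ suc u then walks (u ∸ i) (a + i) (suc (c ∸ i)) else 0))
walks-by-first-descent c zero a = sym (cong suc (∑-zero c (λ _ _ → refl)))
walks-by-first-descent zero (suc u) a =
  trans (cong (λ b → walks (suc u) b 1) (sym (+-identityʳ a))) (sym (+-identityʳ _))
walks-by-first-descent (suc c) (suc u) a =
  trans (+-comm (walks u (suc (suc a)) c) _)
    (cong₂ _+_ (cong (λ b → walks (suc u) b (suc (suc c))) (sym (+-identityʳ a)))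
      (trans (walks-by-first-descent c u (suc a))
        (∑-cong (suc c) (λ i _ →
          cong (λ b → if i <ᵇ suc u then walks (u ∸ i) b (suc (c ∸ i)) else 0) (sym (+-suc a i))))))

walks-split : ∀ u a c →
  walks (suc u) (suc a) c ≡ walks (suc u) a (suc c) + (∑[ i < c ] (if i <ᵇ suc u then walks (u ∸ i) (suc a + i) (c ∸ i) else 0))
walks-split u a zero    = sym (+-identityʳ _)
walks-split u a (suc c) =
  trans (+-comm (walks u (suc (suc a)) c) _)
    (cong (walks (suc u) a (suc (suc c)) +_)
      (trans (walks-by-first-descent c u (suc a))
        (∑-cong (suc c) (λ i i<1+c →
          cong (λ d → if i <ᵇ suc u then walks (u ∸ i) (suc a + i) d else 0)
               (sym (+-∸-assoc 1 (≤-pred i<1+c)))))))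

walks-from-ground : ∀ u c →
  walks (suc u) 0 c ≡ (∑[ i < c ] (if i <ᵇ suc u then walks (u ∸ i) i (c ∸ i) else 0))
walks-from-ground u zero    = refl
walks-from-ground u (suc c) =
  trans (walks-by-first-descent c u 0)
    (∑-cong (suc c) (λ i i<1+c →
      cong (λ d → if i <ᵇ suc u then walks (u ∸ i) i d else 0) (sym (+-∸-assoc 1 (≤-pred i<1+c)))))

rushWalks-unfold : ∀ i u a c →
  (if i <ᵇ suc u then rushWalks (u ∸ i) a c else 0)
    ≡ (if i <ᵇ suc u then walks (u ∸ i) a c else 0) + (if i <ᵇ u then rushWalks (u ∸ suc i) (suc a) c else 0)
rushWalks-unfold zero    zero    a c = refl
rushWalks-unfold zero    (suc u) a c = refl
rushWalks-unfold (suc i) zero    a c = refl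
rushWalks-unfold (suc i) (suc u) a c = rushWalks-unfold i u a c

rushWalks-recurrence : ∀ u a c →
  rushWalks u (suc a) c
    ≡ rushWalks u a (suc c) + (∑[ i < c ] (if i <ᵇ u then rushWalks (u ∸ suc i) (suc a + i) (c ∸ i) else 0))
rushWalks-recurrence zero    a c = sym (cong suc (∑-zero c (λ _ _ → refl)))
rushWalks-recurrence (suc u) a c = begin
  walks (suc u) (suc a) c + rushWalks u (suc (suc a)) c
    ≡⟨ cong₂ _+_ (walks-split u a c) (rushWalks-recurrence u (suc a) c) ⟩
  (walks (suc u) a (suc c) + sumTo c down) + (rushWalks u (suc a) (suc c) + sumTo c rest)
    ≡⟨ +-interchange (walks (suc u) a (suc c)) (sumTo c down) _ (sumTo c rest) ⟩
  rushWalks (suc u) a (suc c) + (sumTo c down + sumTo c rest)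
    ≡⟨ cong (rushWalks (suc u) a (suc c) +_) (sym (∑-+ c down rest)) ⟩
  rushWalks (suc u) a (suc c) + (∑[ i < c ] (down i + rest i))
    ≡⟨ cong (rushWalks (suc u) a (suc c) +_) (∑-cong c (λ i _ → sym (rushWalks-unfold i u (suc a + i) (c ∸ i)))) ⟩
  rushWalks (suc u) a (suc c) + (∑[ i < c ] (if i <ᵇ suc u then rushWalks (u ∸ i) (suc a + i) (c ∸ i) else 0))
    ∎
  where
  open ≡-Reasoning
  down rest : ℕ → ℕ
  down i = if i <ᵇ suc u then walks (u ∸ i) (suc a + i) (c ∸ i) else 0
  rest i = if i <ᵇ u then rushWalks (u ∸ suc i) (suc (suc a) + i) (c ∸ i) else 0

rushWalks-recurrence₀ : ∀ u c →
  rushWalks (suc u) 0 c ≡ rushWalks u 0 (suc c) + (∑[ i < c ] (if i <ᵇ suc u then rushWalks (u ∸ i) i (c ∸ i) else 0))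
rushWalks-recurrence₀ u c = begin
  walks (suc u) 0 c + rushWalks u 1 c
    ≡⟨ cong₂ _+_ (walks-from-ground u c) (rushWalks-recurrence u 0 c) ⟩
  sumTo c down + (rushWalks u 0 (suc c) + sumTo c rest)
    ≡⟨ sym (+-assoc (sumTo c down) _ _) ⟩
  (sumTo c down + rushWalks u 0 (suc c)) + sumTo c rest
    ≡⟨ cong (_+ sumTo c rest) (+-comm (sumTo c down) _) ⟩
  (rushWalks u 0 (suc c) + sumTo c down) + sumTo c rest
    ≡⟨ +-assoc (rushWalks u 0 (suc c)) _ _ ⟩
  rushWalks u 0 (suc c) + (sumTo c down + sumTo c rest)
    ≡⟨ cong (rushWalks u 0 (suc c) +_) (sym (∑-+ c down rest)) ⟩
  rushWalks u 0 (suc c) + (∑[ i < c ] (down i + rest i))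
    ≡⟨ cong (rushWalks u 0 (suc c) +_) (∑-cong c (λ i _ → sym (rushWalks-unfold i u i (c ∸ i)))) ⟩
  rushWalks u 0 (suc c) + (∑[ i < c ] (if i <ᵇ suc u then rushWalks (u ∸ i) i (c ∸ i) else 0))
    ∎
  where
  open ≡-Reasoning
  down rest : ℕ → ℕ
  down i = if i <ᵇ suc u then walks (u ∸ i) i (c ∸ i) else 0
  rest i = if i <ᵇ u then rushWalks (u ∸ suc i) (suc i) (c ∸ i) else 0

-- Q r D k counts the completions by r further entries of an admissible prefix
-- whose length exceeds its maximum by D and which has k pending values.
Q : ℕ → ℕ → ℕ → ℕ
Q zero    D k = if k ≡ᵇ 0 then 1 else 0
Q (suc r) D k = Q r (suc D) (k ∸ 1) + (∑[ i < D ] Q r (D ∸ i) (k + i))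

Q≡rushWalks : ∀ r D k → Q r D k ≡ (if k <ᵇ suc r then rushWalks (r ∸ k) k D else 0)
Q≡rushWalks zero    D zero    = refl
Q≡rushWalks zero    D (suc k) = refl
Q≡rushWalks (suc r) D zero    =
  trans (cong₂ _+_ (Q≡rushWalks r (suc D) 0) (∑-cong D (λ i _ → Q≡rushWalks r (D ∸ i) i)))
        (sym (rushWalks-recurrence₀ r D))
Q≡rushWalks (suc r) D (suc k) with k ≤? r
... | yes k≤r = begin
  Q r (suc D) k + (∑[ i < D ] Q r (D ∸ i) (suc k + i))
    ≡⟨ cong₂ _+_ (Q≡rushWalks r (suc D) k) (∑-cong D (λ i _ → Q≡rushWalks r (D ∸ i) (suc k + i))) ⟩
  (if k <ᵇ suc r then rushWalks u k (suc D) else 0)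
    + (∑[ i < D ] (if suc k + i <ᵇ suc r then rushWalks (r ∸ (suc k + i)) (suc k + i) (D ∸ i) else 0))
    ≡⟨ cong₂ _+_ (cong (λ b → if b then rushWalks u k (suc D) else 0) (<ᵇ-true (s≤s k≤r)))
                 (∑-cong D (λ i _ → shift i)) ⟩
  rushWalks u k (suc D) + (∑[ i < D ] (if i <ᵇ u then rushWalks (u ∸ suc i) (suc k + i) (D ∸ i) else 0))
    ≡⟨ sym (rushWalks-recurrence u k D) ⟩
  rushWalks u (suc k) D
    ≡⟨ cong (λ b → if b then rushWalks u (suc k) D else 0) (sym (<ᵇ-true (s≤s k≤r))) ⟩
  (if k <ᵇ suc r then rushWalks u (suc k) D else 0)
    ∎
  where
  open ≡-Reasoning
  u = r ∸ k
  r≡k+u : r ≡ k + u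
  r≡k+u = sym (m+[n∸m]≡n k≤r)
  shift : ∀ i → (if suc k + i <ᵇ suc r then rushWalks (r ∸ (suc k + i)) (suc k + i) (D ∸ i) else 0)
              ≡ (if i <ᵇ u then rushWalks (u ∸ suc i) (suc k + i) (D ∸ i) else 0)
  shift i = cong₂ (λ b d → if b then rushWalks d (suc k + i) (D ∸ i) else 0)
    (trans (cong (k + i <ᵇ_) r≡k+u) (+-cancelˡ-<ᵇ k i u))
    (trans (cong₂ _∸_ r≡k+u (sym (+-suc k i))) ([m+n]∸[m+o]≡n∸o k u (suc i)))
... | no k≰r =
  trans (cong₂ _+_ (trans (Q≡rushWalks r (suc D) k) (cong (λ b → if b then rushWalks (r ∸ k) k (suc D) else 0) (<ᵇ-false r<k)))
                   (∑-zero D (λ i _ → trans (Q≡rushWalks r (D ∸ i) (suc k + i))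
                     (cong (λ b → if b then rushWalks (r ∸ (suc k + i)) (suc k + i) (D ∸ i) else 0)
                           (<ᵇ-false (≤-trans r<k (≤-trans (n≤1+n k) (m≤m+n (suc k) i))))))))
        (cong (λ b → if b then rushWalks (r ∸ k) (suc k) D else 0) (sym (<ᵇ-false r<k)))
  where
  r<k : suc r ≤ k
  r<k = ≰⇒> k≰r

-- walksOfLength L a c counts walks with L steps from altitude a down to 0 within [0, a + c].
walksOfLength : ℕ → ℕ → ℕ → ℕ
walksOfLength zero    a       c       = if a ≡ᵇ 0 then 1 else 0
walksOfLength (suc L) zero    zero    = 0
walksOfLength (suc L) zero    (suc c) = walksOfLength L 1 c
walksOfLength (suc L) (suc a) zero    = walksOfLength L a 1
walksOfLength (suc L) (suc a) (suc c) = walksOfLength L (suc (suc a)) c + walksOfLength L a (suc (suc c))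

walksOfLength-short : ∀ L a c → L < a → walksOfLength L a c ≡ 0
walksOfLength-short zero    (suc a) c       _         = refl
walksOfLength-short (suc L) (suc a) zero    (s≤s L<a) = walksOfLength-short L a 1 L<a
walksOfLength-short (suc L) (suc a) (suc c) (s≤s L<a) =
  cong₂ _+_ (walksOfLength-short L (suc (suc a)) c (m<n⇒m<1+n (m<n⇒m<1+n L<a)))
            (walksOfLength-short L a (suc (suc c)) L<a)

walksOfLength-straight : ∀ a c → walksOfLength a a c ≡ 1
walksOfLength-straight zero    c       = refl
walksOfLength-straight (suc a) zero    = walksOfLength-straight a 1
walksOfLength-straight (suc a) (suc c) =
  cong₂ _+_ (walksOfLength-short a (suc (suc a)) c (m<n⇒m<1+n (n<1+n a)))
            (walksOfLength-straight a (suc (suc c)))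

walksOfLength≡walks : ∀ u a c → walksOfLength (a + (u + u)) a c ≡ walks u a c
walksOfLength≡walks zero    a       c       = trans (cong (λ L → walksOfLength L a c) (+-identityʳ a)) (walksOfLength-straight a c)
walksOfLength≡walks (suc u) zero    zero    = refl
walksOfLength≡walks (suc u) zero    (suc c) = trans (cong (λ L → walksOfLength L 1 c) (+-suc u u)) (walksOfLength≡walks u 1 c)
walksOfLength≡walks (suc u) (suc a) zero    = walksOfLength≡walks (suc u) a 1
walksOfLength≡walks (suc u) (suc a) (suc c) =
  cong₂ _+_ (trans (cong (λ L → walksOfLength L (suc (suc a)) c) (length-after-up a u)) (walksOfLength≡walks u (suc (suc a)) c))
            (walksOfLength≡walks (suc u) a (suc (suc c)))
  where
  length-after-up : ∀ a u → a + (suc u + suc u) ≡ suc (suc a) + (u + u)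
  length-after-up = solve-∀

-- rushedOfLength L b counts walks with L steps from altitude b down to 0 that
-- rise by some h ≥ 0, step down, and never return to altitude b + h.
rushedOfLength : ℕ → ℕ → ℕ
rushedOfLength zero    b       = 0
rushedOfLength (suc L) zero    = rushedOfLength L 1
rushedOfLength (suc L) (suc c) = rushedOfLength L (suc (suc c)) + walksOfLength L c 0

rushedOfLength-short : ∀ L c → L ≤ c → rushedOfLength L (suc c) ≡ 0
rushedOfLength-short zero    c _   = refl
rushedOfLength-short (suc L) c L<c =
  cong₂ _+_ (rushedOfLength-short L (suc c) (m≤n⇒m≤1+n (<⇒≤ L<c))) (walksOfLength-short L c 0 L<c)

rushedOfLength≡rushWalks : ∀ u c → rushedOfLength (suc (suc c) + (u + u)) (suc (suc c)) ≡ rushWalks u c 1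
rushedOfLength≡rushWalks zero c =
  cong₂ _+_ (rushedOfLength-short (suc (c + 0)) (suc (suc c)) (s≤s (m≤n⇒m≤1+n (≤-reflexive (+-identityʳ c)))))
            (trans (cong (λ L → walksOfLength L (suc c) 0) (cong suc (+-identityʳ c))) (walksOfLength-straight (suc c) 0))
rushedOfLength≡rushWalks (suc u) c =
  trans (cong₂ _+_ (trans (cong (λ L → rushedOfLength L (suc (suc (suc c)))) (length-after-up c u))
                          (rushedOfLength≡rushWalks u (suc c)))
                   (walksOfLength≡walks (suc u) (suc c) 0))
        (+-comm (rushWalks u (suc c) 1) _)
  where
  length-after-up : ∀ c u → suc (c + (suc u + suc u)) ≡ suc (suc (suc c)) + (u + u)
  length-after-up = solve-∀

rushedOfLength-from-ground : ∀ r → rushedOfLength (suc (r + suc (suc r))) 1 ≡ rushWalks r 0 1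
rushedOfLength-from-ground r =
  trans (cong (λ L → rushedOfLength (suc L) 1) (trans (+-suc r (suc r)) (cong suc (+-suc r r))))
        (trans (+-identityʳ _) (rushedOfLength≡rushWalks r 0))

confined : List Bool → ℕ → ℕ → Bool
confined []          a       c       = a ≡ᵇ 0
confined (true  ∷ p) a       zero    = false
confined (true  ∷ p) a       (suc c) = confined p (suc a) c
confined (false ∷ p) zero    c       = false
confined (false ∷ p) (suc a) c       = confined p a (suc c)

count-confined : ∀ L a c → count (λ p → confined p a c) (allBoolLists L) ≡ walksOfLength L a c
count-confined zero    a c = +-identityʳ _
count-confined (suc L) a c = trans (count-allBoolLists L (λ p → confined p a c)) (first-step a c)
  where
  first-step : ∀ a c → count (λ p → confined (true ∷ p) a c) (allBoolLists L)
                       + count (λ p → confined (false ∷ p) a c) (allBoolLists L)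
                       ≡ walksOfLength (suc L) a c
  first-step zero    zero    = cong₂ _+_ (count-false (allBoolLists L)) (count-false (allBoolLists L))
  first-step zero    (suc c) = trans (cong₂ _+_ (count-confined L 1 c) (count-false (allBoolLists L))) (+-identityʳ _)
  first-step (suc a) zero    = cong₂ _+_ (count-false (allBoolLists L)) (count-confined L a 1)
  first-step (suc a) (suc c) = cong₂ _+_ (count-confined L (suc (suc a)) c) (count-confined L a (suc (suc c)))

avoidsAltitude : ℕ → List ℕ → Bool
avoidsAltitude t = all (λ x → not (x ≡ᵇ t))

dyck∧avoids≡confined : ∀ a c p t → t ≡ suc (a + c) → dyckFrom a p ∧ avoidsAltitude t (altsFrom a p) ≡ confined p a c
dyck∧avoids≡confined a       c       []          t t≡ = ∧-identityʳ _
dyck∧avoids≡confined a       zero    (true ∷ p)  t t≡ rewrite t≡ | +-identityʳ a | ≡ᵇ-refl a = ∧-zeroʳ _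
dyck∧avoids≡confined a       (suc c) (true ∷ p)  t t≡
  rewrite ≡ᵇ-false {suc a} {t} (<⇒≢ (subst (suc a <_) (sym (trans t≡ (cong suc (+-suc a c)))) (s≤s (s≤s (m≤m+n a c))))) =
  dyck∧avoids≡confined (suc a) c p t (trans t≡ (cong suc (+-suc a c)))
dyck∧avoids≡confined zero    c       (false ∷ p) t t≡ = refl
dyck∧avoids≡confined (suc a) c       (false ∷ p) t t≡
  rewrite ≡ᵇ-false {a} {t} (<⇒≢ (subst (a <_) (sym t≡) (s≤s (≤-trans (n≤1+n a) (s≤s (m≤m+n a c)))))) =
  dyck∧avoids≡confined a (suc c) p t (trans t≡ (cong suc (sym (+-suc a c))))

x∧z≡false⇒x∧[y∧z]≡false : ∀ x y z → x ∧ z ≡ false → x ∧ (y ∧ z) ≡ false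
x∧z≡false⇒x∧[y∧z]≡false true  y z x∧z≡false rewrite x∧z≡false = ∧-zeroʳ y
x∧z≡false⇒x∧[y∧z]≡false false y z _         = refl

-- A Dyck suffix starting above altitude t has to pass through t.
dyck∧avoids-below≡false : ∀ a t p → t < a → dyckFrom a p ∧ avoidsAltitude t (altsFrom a p) ≡ false
dyck∧avoids-below≡false (suc a) t []          _ = refl
dyck∧avoids-below≡false a       t (true ∷ p)  t<a =
  x∧z≡false⇒x∧[y∧z]≡false (dyckFrom (suc a) p) _ _ (dyck∧avoids-below≡false (suc a) t p (m<n⇒m<1+n t<a))
dyck∧avoids-below≡false (suc a) t (false ∷ p) (s≤s t≤a) with m≤n⇒m<n∨m≡n t≤a
... | inj₁ t<a  = x∧z≡false⇒x∧[y∧z]≡false (dyckFrom a p) _ _ (dyck∧avoids-below≡false a t p t<a)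
... | inj₂ refl rewrite ≡ᵇ-refl t = ∧-zeroʳ _

anyBelow : ℕ → (ℕ → Bool) → Bool
anyBelow zero    P = false
anyBelow (suc n) P = P 0 ∨ anyBelow n (P ∘ suc)

any-applyUpTo : ∀ n (P : A → Bool) (f : ℕ → A) → any P (applyUpTo f n) ≡ anyBelow n (P ∘ f)
any-applyUpTo zero    P f = refl
any-applyUpTo (suc n) P f = cong (P (f 0) ∨_) (any-applyUpTo n P (f ∘ suc))

anyBelow-cong : ∀ n {P R : ℕ → Bool} → (∀ i → P i ≡ R i) → anyBelow n P ≡ anyBelow n R
anyBelow-cong zero    P≗R = refl
anyBelow-cong (suc n) P≗R = cong₂ _∨_ (P≗R 0) (anyBelow-cong n (P≗R ∘ suc))

anyBelow-false : ∀ n {P : ℕ → Bool} → (∀ i → P i ≡ false) → anyBelow n P ≡ false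
anyBelow-false zero    P≗false = refl
anyBelow-false (suc n) P≗false rewrite P≗false 0 = anyBelow-false n (P≗false ∘ suc)

risesThenAvoids : ℕ → ℕ → List Bool → Bool
risesThenAvoids b h p =
  (length (take h p) ≡ᵇ h) ∧ all (λ x → x) (take h p) ∧ avoidsAltitude (b + h) (drop h (altsFrom b p))

rushedFrom : ℕ → List Bool → Bool
rushedFrom b p = anyBelow (suc (length p)) (λ h → risesThenAvoids b h p)

rushed-up : ∀ p → rushed (true ∷ p) ≡ rushedFrom 1 p
rushed-up p = any-applyUpTo (suc (length p)) _ suc

rushedFrom-up : ∀ b p → rushedFrom b (true ∷ p) ≡ risesThenAvoids b 0 (true ∷ p) ∨ rushedFrom (suc b) p
rushedFrom-up b p =
  cong (risesThenAvoids b 0 (true ∷ p) ∨_)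
       (anyBelow-cong (suc (length p)) (λ h → cong (λ t → (length (take h p) ≡ᵇ h) ∧ all (λ x → x) (take h p)
                                                           ∧ avoidsAltitude t (drop h (altsFrom (suc b) p)))
                                                  (+-suc b h)))

rushedFrom-down : ∀ b p → rushedFrom b (false ∷ p) ≡ risesThenAvoids b 0 (false ∷ p)
rushedFrom-down b p =
  trans (cong (risesThenAvoids b 0 (false ∷ p) ∨_)
              (anyBelow-false (suc (length p)) (λ h → ∧-zeroʳ (length (take (suc h) (false ∷ p)) ≡ᵇ suc h))))
        (∨-identityʳ _)

rushedSuffix : ℕ → List Bool → Bool
rushedSuffix b       []          = false
rushedSuffix b       (true ∷ p)  = rushedSuffix (suc b) p
rushedSuffix zero    (false ∷ p) = false
rushedSuffix (suc c) (false ∷ p) = confined p c 0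

x∧z≡false⇒x∧[[y∧z]∨w]≡x∧w : ∀ x y z w → x ∧ z ≡ false → x ∧ ((y ∧ z) ∨ w) ≡ x ∧ w
x∧z≡false⇒x∧[[y∧z]∨w]≡x∧w true  y z w x∧z≡false rewrite x∧z≡false | ∧-zeroʳ y = refl
x∧z≡false⇒x∧[[y∧z]∨w]≡x∧w false y z w _         = refl

dyck∧rushedFrom≡rushedSuffix : ∀ c p → dyckFrom (suc c) p ∧ rushedFrom (suc c) p ≡ rushedSuffix (suc c) p
dyck∧rushedFrom≡rushedSuffix c []          = refl
dyck∧rushedFrom≡rushedSuffix c (true ∷ p)  =
  trans (cong (dyckFrom (suc (suc c)) p ∧_) (rushedFrom-up (suc c) p))
   (trans (x∧z≡false⇒x∧[[y∧z]∨w]≡x∧w (dyckFrom (suc (suc c)) p) (not (suc (suc c) ≡ᵇ suc c + 0))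
                (avoidsAltitude (suc c + 0) (altsFrom (suc (suc c)) p)) (rushedFrom (suc (suc c)) p)
             (dyck∧avoids-below≡false (suc (suc c)) (suc c + 0) p (s≤s (s≤s (≤-reflexive (+-identityʳ c))))))
          (dyck∧rushedFrom≡rushedSuffix (suc c) p))
dyck∧rushedFrom≡rushedSuffix c (false ∷ p)
  rewrite rushedFrom-down (suc c) p | ≡ᵇ-false {c} {suc c + 0} (<⇒≢ (s≤s (≤-reflexive (sym (+-identityʳ c))))) =
  dyck∧avoids≡confined c 0 p (suc c + 0) refl

count-rushedSuffix : ∀ L b → count (rushedSuffix b) (allBoolLists L) ≡ rushedOfLength L b
count-rushedSuffix zero    b       = refl
count-rushedSuffix (suc L) zero    =
  trans (count-allBoolLists L (rushedSuffix 0))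
        (trans (cong₂ _+_ (count-rushedSuffix L 1) (count-false (allBoolLists L))) (+-identityʳ _))
count-rushedSuffix (suc L) (suc c) =
  trans (count-allBoolLists L (rushedSuffix (suc c)))
        (cong₂ _+_ (count-rushedSuffix L (suc (suc c))) (count-confined L c 0))

countRushed≡rushWalks : ∀ r → countRushed (suc (suc r)) ≡ rushWalks r 0 1
countRushed≡rushWalks r = begin
  countRushed (suc (suc r))
    ≡⟨ length-filter≡count rushed (dyckPaths (suc (suc r))) ⟩
  count rushed (dyckPaths (suc (suc r)))
    ≡⟨ count-filter isDyck rushed (allBoolLists (suc L)) ⟩
  count (λ p → isDyck p ∧ rushed p) (allBoolLists (suc L))
    ≡⟨ count-allBoolLists L (λ p → isDyck p ∧ rushed p) ⟩
  count (λ p → dyckFrom 1 p ∧ rushed (true ∷ p)) (allBoolLists L) + count (λ _ → false) (allBoolLists L)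
    ≡⟨ cong₂ _+_ (count-cong (allBoolLists L) (λ p → trans (cong (dyckFrom 1 p ∧_) (rushed-up p))
                                                           (dyck∧rushedFrom≡rushedSuffix 0 p)))
                 (count-false (allBoolLists L)) ⟩
  count (rushedSuffix 1) (allBoolLists L) + 0
    ≡⟨ trans (+-identityʳ _) (count-rushedSuffix L 1) ⟩
  rushedOfLength L 1
    ≡⟨ rushedOfLength-from-ground r ⟩
  rushWalks r 0 1
    ∎
  where
  open ≡-Reasoning
  L = suc r + suc (suc r)

not-==-not : ∀ p q → (not p == not q) ≡ (p == q)
not-==-not true  true  = refl
not-==-not true  false = refl
not-==-not false true  = refl
not-==-not false false = refl

sameRel-refl : ∀ x a → sameRel x x a a ≡ true
sameRel-refl x a rewrite n<ᵇn x | n<ᵇn a | ≡ᵇ-refl x | ≡ᵇ-refl a = refl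

sameRel-sym : ∀ x y a b → sameRel y x b a ≡ sameRel x y a b
sameRel-sym x y a b rewrite ≡ᵇ-sym y x | ≡ᵇ-sym b a with x ≡ᵇ y in x≡ᵇy | a ≡ᵇ b in a≡ᵇb
... | true  | true  rewrite ≡ᵇ-sound {x} {y} x≡ᵇy | ≡ᵇ-sound {a} {b} a≡ᵇb = refl
... | true  | false = trans (∧-zeroʳ _) (sym (∧-zeroʳ _))
... | false | true  = trans (∧-zeroʳ _) (sym (∧-zeroʳ _))
... | false | false rewrite <ᵇ-flip {x} {y} x≡ᵇy | <ᵇ-flip {a} {b} a≡ᵇb = cong (_∧ true) (not-==-not (x <ᵇ y) (a <ᵇ b))

-- Of the nine comparisons made by orderIso, the diagonal ones hold trivially
-- and the others come in symmetric pairs.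
orderIso₃ : ∀ x y z a b c →
  orderIso (x ∷ y ∷ z ∷ []) (a ∷ b ∷ c ∷ []) ≡ sameRel x y a b ∧ sameRel x z a c ∧ sameRel y z b c
orderIso₃ x y z a b c
  rewrite sameRel-refl x a | sameRel-refl y b | sameRel-refl z c
        | sameRel-sym x y a b | sameRel-sym x z a c | sameRel-sym y z b c =
  pairwise (sameRel x y a b) (sameRel x z a c) (sameRel y z b c)
  where
  pairwise : ∀ p q r → (true ∧ p ∧ q ∧ true) ∧ (p ∧ true ∧ r ∧ true) ∧ (q ∧ r ∧ true ∧ true) ∧ true ≡ p ∧ q ∧ r
  pairwise false q     r     = refl
  pairwise true  false r     = refl
  pairwise true  true  true  = refl
  pairwise true  true  false = refl

sameRel-< : ∀ x y {a b} → a < b → sameRel x y a b ≡ (x <ᵇ y)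
sameRel-< x y {a} {b} a<b rewrite <ᵇ-true a<b | ≡ᵇ-false (<⇒≢ a<b) with <-cmp x y
... | tri< x<y _ _ rewrite <ᵇ-true x<y | ≡ᵇ-false (<⇒≢ x<y) = refl
... | tri≈ _ refl _ rewrite n<ᵇn x = refl
... | tri> _ _ y<x rewrite <ᵇ-false {x} {y} (<⇒≤ y<x) = refl

sameRel-≡ : ∀ x y a → sameRel x y a a ≡ (x ≡ᵇ y)
sameRel-≡ x y a rewrite n<ᵇn a | ≡ᵇ-refl a with x ≡ᵇ y in x≡ᵇy
... | true  rewrite ≡ᵇ-sound {x} {y} x≡ᵇy | n<ᵇn y = refl
... | false = ∧-zeroʳ _

sameRel-> : ∀ x y {a b} → b < a → sameRel x y a b ≡ (y <ᵇ x)
sameRel-> x y {a} {b} b<a rewrite <ᵇ-false {a} {b} (<⇒≤ b<a) | ≡ᵇ-false {a} {b} (λ a≡b → <⇒≢ b<a (sym a≡b)) with <-cmp x y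
... | tri< x<y _ _ rewrite <ᵇ-true x<y | <ᵇ-false {y} {x} (<⇒≤ x<y) = refl
... | tri≈ _ refl _ rewrite n<ᵇn x | ≡ᵇ-refl x = refl
... | tri> _ _ y<x rewrite <ᵇ-false {x} {y} (<⇒≤ y<x) | ≡ᵇ-false {x} {y} (λ x≡y → <⇒≢ y<x (sym x≡y)) | <ᵇ-true y<x = refl

occurs011 occurs201 : ℕ → ℕ → ℕ → Bool
occurs011 x y z = (y ≡ᵇ z) ∧ (x <ᵇ y)
occurs201 x y z = (y <ᵇ z) ∧ (z <ᵇ x)

orderIso-011 : ∀ x y z → orderIso (x ∷ y ∷ z ∷ []) (0 ∷ 1 ∷ 1 ∷ []) ≡ occurs011 x y z
orderIso-011 x y z
  rewrite orderIso₃ x y z 0 1 1 | sameRel-< x y {0} {1} z<s | sameRel-< x z {0} {1} z<s | sameRel-≡ y z 1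
  with y ≡ᵇ z in y≡ᵇz
... | true  rewrite ≡ᵇ-sound {y} {z} y≡ᵇz = trans (sym (∧-assoc (x <ᵇ z) _ true)) (trans (∧-identityʳ _) (∧-idem _))
... | false = trans (cong ((x <ᵇ y) ∧_) (∧-zeroʳ _)) (∧-zeroʳ _)

orderIso-201 : ∀ x y z → orderIso (x ∷ y ∷ z ∷ []) (2 ∷ 0 ∷ 1 ∷ []) ≡ occurs201 x y z
orderIso-201 x y z
  rewrite orderIso₃ x y z 2 0 1 | sameRel-> x y {2} {0} z<s | sameRel-> x z {2} {1} (s<s z<s) | sameRel-< y z {0} {1} z<s
  with y <ᵇ z in y<ᵇz | z <ᵇ x in z<ᵇx
... | true  | true  rewrite <ᵇ-true (<-trans (<ᵇ-sound {y} {z} y<ᵇz) (<ᵇ-sound {z} {x} z<ᵇx)) = refl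
... | true  | false = ∧-zeroʳ _
... | false | z<x   = trans (cong ((y <ᵇ x) ∧_) (∧-zeroʳ z<x)) (∧-zeroʳ _)


any-++ : ∀ (P : A → Bool) xs ys → any P (xs ++ ys) ≡ any P xs ∨ any P ys
any-++ P []       ys = refl
any-++ P (x ∷ xs) ys = trans (cong (P x ∨_) (any-++ P xs ys)) (sym (∨-assoc (P x) _ _))

any-map : ∀ (P : B → Bool) (f : A → B) xs → any P (map f xs) ≡ any (P ∘ f) xs
any-map P f []       = refl
any-map P f (x ∷ xs) = cong (P (f x) ∨_) (any-map P f xs)

any-cong : ∀ {P R : A → Bool} xs → (∀ x → P x ≡ R x) → any P xs ≡ any R xs
any-cong []       P≗R = refl
any-cong (x ∷ xs) P≗R = cong₂ _∨_ (P≗R x) (any-cong xs P≗R)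

any-false : ∀ (xs : List A) → any (λ _ → false) xs ≡ false
any-false []       = refl
any-false (x ∷ xs) = any-false xs

any-∧ˡ : ∀ b (P : A → Bool) xs → any (λ x → b ∧ P x) xs ≡ b ∧ any P xs
any-∧ˡ true  P xs = refl
any-∧ˡ false P xs = any-false xs

any-snoc : ∀ (P : A → Bool) xs z → any P (xs ++ z ∷ []) ≡ any P xs ∨ P z
any-snoc P xs z = trans (any-++ P xs (z ∷ [])) (cong (any P xs ∨_) (∨-identityʳ (P z)))

anyPair : (A → A → Bool) → List A → Bool
anyPair R []       = false
anyPair R (x ∷ xs) = any (R x) xs ∨ anyPair R xs

anyTriple : (A → A → A → Bool) → List A → Bool
anyTriple R []       = false
anyTriple R (x ∷ xs) = anyPair (R x) xs ∨ anyTriple R xs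

anyPair-snoc : ∀ (R : A → A → Bool) xs z → anyPair R (xs ++ z ∷ []) ≡ anyPair R xs ∨ any (λ x → R x z) xs
anyPair-snoc R []       z = refl
anyPair-snoc R (x ∷ xs) z =
  trans (cong₂ _∨_ (any-snoc (R x) xs z) (anyPair-snoc R xs z))
        (∨-interchange (any (R x) xs) (R x z) (anyPair R xs) _)

anyTriple-snoc : ∀ (R : A → A → A → Bool) xs z → anyTriple R (xs ++ z ∷ []) ≡ anyTriple R xs ∨ anyPair (λ x y → R x y z) xs
anyTriple-snoc R []       z = refl
anyTriple-snoc R (x ∷ xs) z =
  trans (cong₂ _∨_ (anyPair-snoc (R x) xs z) (anyTriple-snoc R xs z))
        (∨-interchange (anyPair (R x) xs) _ (anyTriple R xs) _)

anyPair-false : ∀ (R : A → A → Bool) xs → (∀ x y → R x y ≡ false) → anyPair R xs ≡ false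
anyPair-false R []       R≗false = refl
anyPair-false R (x ∷ xs) R≗false
  rewrite anyPair-false R xs R≗false = trans (∨-identityʳ _) (trans (any-cong xs (R≗false x)) (any-false xs))

whenEmpty : Bool → List A → Bool
whenEmpty b []      = b
whenEmpty b (_ ∷ _) = false

whenSingleton : (A → Bool) → List A → Bool
whenSingleton P []      = false
whenSingleton P (x ∷ s) = whenEmpty (P x) s

whenPair : (A → A → Bool) → List A → Bool
whenPair R []      = false
whenPair R (x ∷ s) = whenSingleton (R x) s

whenTriple : (A → A → A → Bool) → List A → Bool
whenTriple R []      = false
whenTriple R (x ∷ s) = whenPair (R x) s

any-subseqs-∷ : ∀ (P : List A → Bool) x xs → any P (subseqs (x ∷ xs)) ≡ any (P ∘ (x ∷_)) (subseqs xs) ∨ any P (subseqs xs)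
any-subseqs-∷ P x xs =
  trans (any-++ P (map (x ∷_) (subseqs xs)) (subseqs xs)) (cong (_∨ any P (subseqs xs)) (any-map P (x ∷_) (subseqs xs)))

any-subseqs-whenEmpty : ∀ b (xs : List A) → any (whenEmpty b) (subseqs xs) ≡ b
any-subseqs-whenEmpty b []       = ∨-identityʳ b
any-subseqs-whenEmpty b (x ∷ xs) =
  trans (any-subseqs-∷ (whenEmpty b) x xs)
        (trans (cong (_∨ any (whenEmpty b) (subseqs xs)) (any-false (subseqs xs))) (any-subseqs-whenEmpty b xs))

any-subseqs-whenSingleton : ∀ (P : A → Bool) xs → any (whenSingleton P) (subseqs xs) ≡ any P xs
any-subseqs-whenSingleton P []       = refl
any-subseqs-whenSingleton P (x ∷ xs) =
  trans (any-subseqs-∷ (whenSingleton P) x xs) (cong₂ _∨_ (any-subseqs-whenEmpty (P x) xs) (any-subseqs-whenSingleton P xs))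

any-subseqs-whenPair : ∀ (R : A → A → Bool) xs → any (whenPair R) (subseqs xs) ≡ anyPair R xs
any-subseqs-whenPair R []       = refl
any-subseqs-whenPair R (x ∷ xs) =
  trans (any-subseqs-∷ (whenPair R) x xs) (cong₂ _∨_ (any-subseqs-whenSingleton (R x) xs) (any-subseqs-whenPair R xs))

any-subseqs-whenTriple : ∀ (R : A → A → A → Bool) xs → any (whenTriple R) (subseqs xs) ≡ anyTriple R xs
any-subseqs-whenTriple R []       = refl
any-subseqs-whenTriple R (x ∷ xs) =
  trans (any-subseqs-∷ (whenTriple R) x xs) (cong₂ _∨_ (any-subseqs-whenPair (R x) xs) (any-subseqs-whenTriple R xs))

contains-triple : ∀ a b c (R : ℕ → ℕ → ℕ → Bool) →
  (∀ x y z → orderIso (x ∷ y ∷ z ∷ []) (a ∷ b ∷ c ∷ []) ≡ R x y z) →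
  ∀ e → contains e (a ∷ b ∷ c ∷ []) ≡ anyTriple R e
contains-triple a b c R iso e = trans (any-cong (subseqs e) orderIso≗whenTriple) (any-subseqs-whenTriple R e)
  where
  orderIso≗whenTriple : ∀ s → orderIso s (a ∷ b ∷ c ∷ []) ≡ whenTriple R s
  orderIso≗whenTriple []                    = refl
  orderIso≗whenTriple (x ∷ [])              = refl
  orderIso≗whenTriple (x ∷ y ∷ [])          = refl
  orderIso≗whenTriple (x ∷ y ∷ z ∷ [])      = iso x y z
  orderIso≗whenTriple (x ∷ y ∷ z ∷ _ ∷ _)   = refl

not-∨ : ∀ a b → not (a ∨ b) ≡ not a ∧ not b
not-∨ true  b = refl
not-∨ false b = refl

isInvFrom-∷ʳ : ∀ j P z → isInvFrom j (P ∷ʳ z) ≡ isInvFrom j P ∧ (z <ᵇ j + length P)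
isInvFrom-∷ʳ j []      z = trans (∧-identityʳ _) (cong (z <ᵇ_) (sym (+-identityʳ j)))
isInvFrom-∷ʳ j (x ∷ P) z rewrite isInvFrom-∷ʳ (suc j) P z | +-suc j (length P) = sym (∧-assoc (x <ᵇ j) _ _)

forbidden : List ℕ → ℕ → Bool
forbidden P v = anyPair (λ x y → occurs011 x y v) P ∨ anyPair (λ x y → occurs201 x y v) P

canExtend : List ℕ → ℕ → Bool
canExtend P v = (v <ᵇ suc (length P)) ∧ not (forbidden P v)

admissible : List ℕ → Bool
admissible P = isInvSeq P ∧ (not (anyTriple occurs011 P) ∧ not (anyTriple occurs201 P))

balanced : List ℕ → Bool
balanced e = bounce e ≡ᵇ zeros e

accepts : List ℕ → List ℕ → Bool
accepts P []      = balanced P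
accepts P (z ∷ e) = canExtend P z ∧ accepts (P ∷ʳ z) e

admissible-∷ʳ : ∀ P z → admissible (P ∷ʳ z) ≡ admissible P ∧ canExtend P z
admissible-∷ʳ P z = begin
  isInvSeq (P ∷ʳ z) ∧ (not (anyTriple occurs011 (P ∷ʳ z)) ∧ not (anyTriple occurs201 (P ∷ʳ z)))
    ≡⟨ cong₂ (λ i o → i ∧ o) (isInvFrom-∷ʳ 1 P z)
             (cong₂ (λ a b → not a ∧ not b) (anyTriple-snoc occurs011 P z) (anyTriple-snoc occurs201 P z)) ⟩
  (inv ∧ inRange) ∧ (not (old011 ∨ new011) ∧ not (old201 ∨ new201))
    ≡⟨ cong ((inv ∧ inRange) ∧_) (cong₂ _∧_ (not-∨ old011 new011) (not-∨ old201 new201)) ⟩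
  (inv ∧ inRange) ∧ ((not old011 ∧ not new011) ∧ (not old201 ∧ not new201))
    ≡⟨ cong ((inv ∧ inRange) ∧_) (∧-interchange (not old011) (not new011) (not old201) (not new201)) ⟩
  (inv ∧ inRange) ∧ ((not old011 ∧ not old201) ∧ (not new011 ∧ not new201))
    ≡⟨ ∧-interchange inv inRange _ _ ⟩
  admissible P ∧ (inRange ∧ (not new011 ∧ not new201))
    ≡⟨ cong (λ b → admissible P ∧ (inRange ∧ b)) (sym (not-∨ new011 new201)) ⟩
  admissible P ∧ canExtend P z
    ∎
  where
  open ≡-Reasoning
  inv = isInvSeq P
  inRange = z <ᵇ suc (length P)
  old011 = anyTriple occurs011 P
  old201 = anyTriple occurs201 P
  new011 = anyPair (λ x y → occurs011 x y z) P
  new201 = anyPair (λ x y → occurs201 x y z) P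

admissible∧balanced≡accepts : ∀ P e → admissible (P ++ e) ∧ balanced (P ++ e) ≡ admissible P ∧ accepts P e
admissible∧balanced≡accepts P []      rewrite ++-identityʳ P = refl
admissible∧balanced≡accepts P (z ∷ e) = begin
  admissible (P ++ z ∷ e) ∧ balanced (P ++ z ∷ e)
    ≡⟨ cong (λ e′ → admissible e′ ∧ balanced e′) (sym (++-assoc P (z ∷ []) e)) ⟩
  admissible ((P ∷ʳ z) ++ e) ∧ balanced ((P ∷ʳ z) ++ e)
    ≡⟨ admissible∧balanced≡accepts (P ∷ʳ z) e ⟩
  admissible (P ∷ʳ z) ∧ accepts (P ∷ʳ z) e
    ≡⟨ cong (_∧ accepts (P ∷ʳ z) e) (admissible-∷ʳ P z) ⟩
  (admissible P ∧ canExtend P z) ∧ accepts (P ∷ʳ z) e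
    ≡⟨ ∧-assoc (admissible P) _ _ ⟩
  admissible P ∧ accepts P (z ∷ e)
    ∎
  where open ≡-Reasoning

isInvSeq∧good≡accepts : ∀ e → isInvSeq e ∧ good e ≡ accepts [] e
isInvSeq∧good≡accepts e = begin
  isInvSeq e ∧ (not c011 ∧ (not c201 ∧ balanced e))
    ≡⟨ cong (λ b → isInvSeq e ∧ b) (sym (∧-assoc (not c011) (not c201) _)) ⟩
  isInvSeq e ∧ ((not c011 ∧ not c201) ∧ balanced e)
    ≡⟨ sym (∧-assoc (isInvSeq e) _ _) ⟩
  (isInvSeq e ∧ (not c011 ∧ not c201)) ∧ balanced e
    ≡⟨ cong (λ b → (isInvSeq e ∧ b) ∧ balanced e)
            (cong₂ (λ a b → not a ∧ not b) (contains-triple 0 1 1 occurs011 orderIso-011 e)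
                                           (contains-triple 2 0 1 occurs201 orderIso-201 e)) ⟩
  admissible e ∧ balanced e
    ≡⟨ admissible∧balanced≡accepts [] e ⟩
  accepts [] e
    ∎
  where
  open ≡-Reasoning
  c011 = contains e (0 ∷ 1 ∷ 1 ∷ [])
  c201 = contains e (2 ∷ 0 ∷ 1 ∷ [])

countGood≡count-accepts : ∀ n → countGood n ≡ count (accepts []) (allLists n n)
countGood≡count-accepts n =
  trans (length-filter≡count good (invSeqs n))
        (trans (count-filter isInvSeq good (allLists n n)) (count-cong (allLists n n) isInvSeq∧good≡accepts))

length-∷ʳ : ∀ (P : List ℕ) x → length (P ∷ʳ x) ≡ suc (length P)
length-∷ʳ P x = trans (length-++ P) (+-comm (length P) 1)

maxL-∷ʳ : ∀ P x → maxL (P ∷ʳ x) ≡ maxL P ⊔ x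
maxL-∷ʳ []      x = ⊔-identityʳ x
maxL-∷ʳ (y ∷ P) x = trans (cong (y ⊔_) (maxL-∷ʳ P x)) (sym (⊔-assoc y (maxL P) x))

zeros-∷ʳ : ∀ P x → zeros (P ∷ʳ x) ≡ zeros P + (if x ≡ᵇ 0 then 1 else 0)
zeros-∷ʳ []          zero    = refl
zeros-∷ʳ []          (suc x) = refl
zeros-∷ʳ (zero ∷ P)  x       = cong suc (zeros-∷ʳ P x)
zeros-∷ʳ (suc y ∷ P) x       = zeros-∷ʳ P x

any-<ᵇ-with-zero : ∀ P → 1 ≤ zeros P → ∀ w → any (_<ᵇ w) P ≡ (0 <ᵇ w)
any-<ᵇ-with-zero (zero  ∷ P) _        zero    = any-false P
any-<ᵇ-with-zero (zero  ∷ P) _        (suc w) = refl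
any-<ᵇ-with-zero (suc x ∷ P) has-zero zero    = any-<ᵇ-with-zero P has-zero zero
any-<ᵇ-with-zero (suc x ∷ P) has-zero (suc w) = trans (cong ((x <ᵇ w) ∨_) (any-<ᵇ-with-zero P has-zero (suc w))) (∨-zeroʳ _)

<ᵇ-⊔ : ∀ v a b → (v <ᵇ a ⊔ b) ≡ (v <ᵇ a) ∨ (v <ᵇ b)
<ᵇ-⊔ v a b with ≤-total a b
... | inj₁ a≤b rewrite m≤n⇒m⊔n≡n a≤b with v <ᵇ a in v<ᵇa
...   | true  = <ᵇ-true (<-≤-trans (<ᵇ-sound v<ᵇa) a≤b)
...   | false = refl
<ᵇ-⊔ v a b | inj₂ b≤a rewrite m≥n⇒m⊔n≡m b≤a with v <ᵇ b in v<ᵇb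
...   | true  = trans (<ᵇ-true (<-≤-trans (<ᵇ-sound v<ᵇb) b≤a)) (sym (∨-zeroʳ _))
...   | false = sym (∨-identityʳ _)

any-<ᵇ≡<ᵇ-maxL : ∀ v P → any (v <ᵇ_) P ≡ (v <ᵇ maxL P)
any-<ᵇ≡<ᵇ-maxL v []      = refl
any-<ᵇ≡<ᵇ-maxL v (y ∷ P) = trans (cong ((v <ᵇ y) ∨_) (any-<ᵇ≡<ᵇ-maxL v P)) (sym (<ᵇ-⊔ v y (maxL P)))

-- Appending w creates a 011 ending in v iff w = v is positive (a 0 precedes it),
-- and a 201 ending in v iff w < v < max P.
forbidden-∷ʳ : ∀ P w v → 1 ≤ zeros P →
  forbidden (P ∷ʳ w) v ≡ forbidden P v ∨ (((w ≡ᵇ v) ∧ (0 <ᵇ w)) ∨ ((w <ᵇ v) ∧ (v <ᵇ maxL P)))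
forbidden-∷ʳ P w v has-zero = begin
  anyPair (λ x y → occurs011 x y v) (P ∷ʳ w) ∨ anyPair (λ x y → occurs201 x y v) (P ∷ʳ w)
    ≡⟨ cong₂ _∨_ (anyPair-snoc (λ x y → occurs011 x y v) P w) (anyPair-snoc (λ x y → occurs201 x y v) P w) ⟩
  (anyPair (λ x y → occurs011 x y v) P ∨ new011) ∨ (anyPair (λ x y → occurs201 x y v) P ∨ new201)
    ≡⟨ ∨-interchange (anyPair (λ x y → occurs011 x y v) P) new011 _ new201 ⟩
  forbidden P v ∨ (new011 ∨ new201)
    ≡⟨ cong (forbidden P v ∨_) (cong₂ _∨_
         (trans (any-∧ˡ (w ≡ᵇ v) (_<ᵇ w) P) (cong ((w ≡ᵇ v) ∧_) (any-<ᵇ-with-zero P has-zero w)))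
         (trans (any-∧ˡ (w <ᵇ v) (v <ᵇ_) P) (cong ((w <ᵇ v) ∧_) (any-<ᵇ≡<ᵇ-maxL v P)))) ⟩
  forbidden P v ∨ (((w ≡ᵇ v) ∧ (0 <ᵇ w)) ∨ ((w <ᵇ v) ∧ (v <ᵇ maxL P)))
    ∎
  where
  open ≡-Reasoning
  new011 = any (λ x → occurs011 x w v) P
  new201 = any (λ x → occurs201 x w v) P

forbidden-zero : ∀ P → forbidden P 0 ≡ false
forbidden-zero P = cong₂ _∨_ (anyPair-false _ P no011) (anyPair-false _ P (λ _ _ → refl))
  where
  no011 : ∀ x y → occurs011 x y 0 ≡ false
  no011 x zero    = refl
  no011 x (suc y) = refl

_∈ᵇ_ : ℕ → List ℕ → Bool
v ∈ᵇ S = any (v ≡ᵇ_) S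

DescendingBelow : ℕ → List ℕ → Set
DescendingBelow b []      = ⊤
DescendingBelow b (t ∷ S) = 0 < t × t < b × DescendingBelow t S

DescendingBelow-weaken : ∀ {b b′} S → b ≤ b′ → DescendingBelow b S → DescendingBelow b′ S
DescendingBelow-weaken []      _    _               = tt
DescendingBelow-weaken (t ∷ S) b≤b′ (0<t , t<b , S↓) = 0<t , <-≤-trans t<b b≤b′ , S↓

∈ᵇ-above : ∀ {b} S v → DescendingBelow b S → b ≤ v → v ∈ᵇ S ≡ false
∈ᵇ-above []      v _               _   = refl
∈ᵇ-above (t ∷ S) v (_ , t<b , S↓) b≤v
  rewrite ≡ᵇ-false {v} {t} (λ v≡t → <⇒≢ (<-≤-trans t<b b≤v) (sym v≡t)) = ∈ᵇ-above S v S↓ (≤-trans (<⇒≤ t<b) b≤v)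

∈ᵇ-bounds : ∀ {b} S v → DescendingBelow b S → v ∈ᵇ S ≡ true → 0 < v × v < b
∈ᵇ-bounds (t ∷ S) v (0<t , t<b , S↓) v∈S with v ≡ᵇ t in v≡ᵇt
... | true  rewrite ≡ᵇ-sound {v} {t} v≡ᵇt = 0<t , t<b
... | false with ∈ᵇ-bounds S v S↓ v∈S
...   | 0<v , v<t = 0<v , <-trans v<t t<b

keepBelow : ℕ → List ℕ → List ℕ
keepBelow x []      = []
keepBelow x (t ∷ S) = if t <ᵇ x then t ∷ keepBelow x S else keepBelow x S

∈ᵇ-keepBelow : ∀ x S v → v ∈ᵇ keepBelow x S ≡ v ∈ᵇ S ∧ (v <ᵇ x)
∈ᵇ-keepBelow x []      v = refl
∈ᵇ-keepBelow x (t ∷ S) v with t <ᵇ x in t<ᵇx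
... | true with v ≡ᵇ t in v≡ᵇt
...   | true  rewrite ≡ᵇ-sound {v} {t} v≡ᵇt | t<ᵇx = refl
...   | false = ∈ᵇ-keepBelow x S v
∈ᵇ-keepBelow x (t ∷ S) v | false with v ≡ᵇ t in v≡ᵇt
...   | false = ∈ᵇ-keepBelow x S v
...   | true  rewrite ≡ᵇ-sound {v} {t} v≡ᵇt | t<ᵇx =
  trans (∈ᵇ-keepBelow x S t) (trans (cong (t ∈ᵇ S ∧_) t<ᵇx) (∧-zeroʳ _))

keepBelow-descending : ∀ {b} x S → DescendingBelow b S → DescendingBelow b (keepBelow x S)
keepBelow-descending x []      _                 = tt
keepBelow-descending x (t ∷ S) (0<t , t<b , S↓) with t <ᵇ x
... | true  = 0<t , t<b , keepBelow-descending x S S↓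
... | false = DescendingBelow-weaken (keepBelow x S) (<⇒≤ t<b) (keepBelow-descending x S S↓)

length-keepBelow : ∀ x S → length (keepBelow x S) ≤ length S
length-keepBelow x []      = z≤n
length-keepBelow x (t ∷ S) with t <ᵇ x
... | true  = s≤s (length-keepBelow x S)
... | false = m≤n⇒m≤1+n (length-keepBelow x S)

length-keepBelow-∈ : ∀ x S → x ∈ᵇ S ≡ true → length (keepBelow x S) < length S
length-keepBelow-∈ x (t ∷ S) x∈S with x ≡ᵇ t in x≡ᵇt
... | true  rewrite ≡ᵇ-sound {x} {t} x≡ᵇt | n<ᵇn t = s≤s (length-keepBelow t S)
... | false with t <ᵇ x
...   | true  = s≤s (length-keepBelow-∈ x S x∈S)
...   | false = m<n⇒m<1+n (length-keepBelow-∈ x S x∈S)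

keepBelow-all : ∀ {b} S → DescendingBelow b S → keepBelow b S ≡ S
keepBelow-all []      _                = refl
keepBelow-all (t ∷ S) (_ , t<b , S↓) rewrite <ᵇ-true t<b = cong (t ∷_) (keepBelow-all S (DescendingBelow-weaken S (<⇒≤ t<b) S↓))

keepBelow-zero : ∀ S → keepBelow 0 S ≡ []
keepBelow-zero []      = refl
keepBelow-zero (t ∷ S) = keepBelow-zero S

skipped : ℕ → ℕ → List ℕ
skipped M zero    = []
skipped M (suc i) = M + suc i ∷ skipped M i

length-skipped : ∀ M i → length (skipped M i) ≡ i
length-skipped M zero    = refl
length-skipped M (suc i) = cong suc (length-skipped M i)

∈ᵇ-skipped : ∀ M i v → v ∈ᵇ skipped M i ≡ (M <ᵇ v) ∧ (v <ᵇ suc (M + i))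
∈ᵇ-skipped M zero v with M <ᵇ v in M<ᵇv
... | false = refl
... | true  = sym (<ᵇ-false (subst (_≤ v) (cong suc (sym (+-identityʳ M))) (<ᵇ-sound {M} {v} M<ᵇv)))
∈ᵇ-skipped M (suc i) v rewrite ∈ᵇ-skipped M i v with <-cmp v (M + suc i)
... | tri< v<M+1+i _ _
  rewrite ≡ᵇ-false (<⇒≢ v<M+1+i) | <ᵇ-true {v} {suc (M + suc i)} (m<n⇒m<1+n v<M+1+i)
        | <ᵇ-true {v} {suc (M + i)} (subst (v <_) (+-suc M i) v<M+1+i) = refl
... | tri≈ _ refl _
  rewrite ≡ᵇ-refl (M + suc i) | <ᵇ-true {M} {M + suc i} (subst (M <_) (sym (+-suc M i)) (s≤s (m≤m+n M i)))
        | <ᵇ-true {M + suc i} {suc (M + suc i)} ≤-refl = refl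
... | tri> _ _ M+1+i<v
  rewrite ≡ᵇ-false {v} {M + suc i} (λ v≡ → <⇒≢ M+1+i<v (sym v≡)) | <ᵇ-false {v} {suc (M + suc i)} M+1+i<v
        | <ᵇ-false {v} {suc (M + i)} (≤-trans (≤-reflexive (sym (+-suc M i))) (<⇒≤ M+1+i<v)) = refl

skipped-descending : ∀ M i S → DescendingBelow M S → DescendingBelow (suc (M + i)) (skipped M i ++ S)
skipped-descending M zero    S S↓ = DescendingBelow-weaken S (≤-trans (n≤1+n M) (≤-reflexive (cong suc (sym (+-identityʳ M))))) S↓
skipped-descending M (suc i) S S↓ =
  subst (0 <_) (sym (+-suc M i)) z<s , ≤-refl ,
  subst (λ b → DescendingBelow b (skipped M i ++ S)) (sym (+-suc M i)) (skipped-descending M i S S↓)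

-- u is the number of nonzero entries of P; the positive values that may follow P
-- are those above max P and the pending values S.
record PrefixState (P S : List ℕ) (u : ℕ) : Set where
  field
    max<length     : maxL P < length P
    length≡zeros+u : length P ≡ zeros P + u
    has-zero       : 1 ≤ zeros P
    u+pending≤max  : u + length S ≤ maxL P
    pending↓       : DescendingBelow (maxL P) S
    forbidden-iff  : ∀ v → 0 < v → forbidden P v ≡ not (v ∈ᵇ S ∨ (maxL P <ᵇ v))

initialState : PrefixState (0 ∷ []) [] 0
initialState = record
  { max<length     = s≤s z≤n
  ; length≡zeros+u = refl
  ; has-zero       = s≤s z≤n
  ; u+pending≤max  = z≤n
  ; pending↓       = tt
  ; forbidden-iff  = λ { (suc v) _ → refl }
  }

state-∷ʳ-low : ∀ {P S u} x u′ → PrefixState P S u → x ≤ maxL P →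
  suc (length P) ≡ (zeros P + (if x ≡ᵇ 0 then 1 else 0)) + u′ →
  u′ + length (keepBelow x S) ≤ maxL P →
  PrefixState (P ∷ʳ x) (keepBelow x S) u′
state-∷ʳ-low {P} {S} {u} x u′ st x≤M length≡ bound = record
  { max<length     = subst₂ _<_ (sym max≡) (sym (length-∷ʳ P x)) (m<n⇒m<1+n max<length)
  ; length≡zeros+u = trans (length-∷ʳ P x) (trans length≡ (cong (_+ u′) (sym (zeros-∷ʳ P x))))
  ; has-zero       = ≤-trans has-zero (subst (zeros P ≤_) (sym (zeros-∷ʳ P x)) (m≤m+n _ _))
  ; u+pending≤max  = subst (u′ + length (keepBelow x S) ≤_) (sym max≡) bound
  ; pending↓       = subst (λ b → DescendingBelow b (keepBelow x S)) (sym max≡) (keepBelow-descending x S pending↓)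
  ; forbidden-iff  = forbidden-iff′
  }
  where
  open PrefixState st
  M = maxL P
  max≡ : maxL (P ∷ʳ x) ≡ M
  max≡ = trans (maxL-∷ʳ P x) (m≥n⇒m⊔n≡m x≤M)
  forbidden-iff′ : ∀ v → 0 < v → forbidden (P ∷ʳ x) v ≡ not (v ∈ᵇ keepBelow x S ∨ (maxL (P ∷ʳ x) <ᵇ v))
  forbidden-iff′ v 0<v
    rewrite forbidden-∷ʳ P x v has-zero | max≡ | ∈ᵇ-keepBelow x S v | forbidden-iff v 0<v with <-cmp M v
  ... | tri< M<v _ _
    rewrite ∈ᵇ-above S v pending↓ (<⇒≤ M<v) | <ᵇ-true M<v | ≡ᵇ-false {x} {v} (<⇒≢ (≤-<-trans x≤M M<v))
          | <ᵇ-false {v} {M} (<⇒≤ M<v) = ∧-zeroʳ _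
  ... | tri≈ _ refl _ rewrite ∈ᵇ-above S M pending↓ ≤-refl | n<ᵇn M = refl
  ... | tri> _ _ v<M rewrite <ᵇ-false {M} {v} (<⇒≤ v<M) | <ᵇ-true v<M with v ∈ᵇ S
  ...   | false = refl
  ...   | true with <-cmp x v
  ...     | tri< x<v _ _ rewrite ≡ᵇ-false (<⇒≢ x<v) | <ᵇ-true x<v | <ᵇ-false {v} {x} (<⇒≤ x<v) = refl
  ...     | tri≈ _ refl _ rewrite ≡ᵇ-refl x | <ᵇ-true 0<v | n<ᵇn x = refl
  ...     | tri> _ _ v<x
    rewrite ≡ᵇ-false {x} {v} (λ x≡v → <⇒≢ v<x (sym x≡v)) | <ᵇ-false {x} {v} (<⇒≤ v<x) | <ᵇ-true v<x = refl

state-∷ʳ-high : ∀ {P S u} i → PrefixState P S u → suc (maxL P + i) ≤ length P →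
  PrefixState (P ∷ʳ suc (maxL P + i)) (skipped (maxL P) i ++ S) (suc u)
state-∷ʳ-high {P} {S} {u} i st x≤length = record
  { max<length     = subst₂ _<_ (sym max≡) (sym (length-∷ʳ P x)) (s≤s x≤length)
  ; length≡zeros+u = trans (length-∷ʳ P x) (trans (cong suc length≡zeros+u)
                       (trans (sym (+-suc (zeros P) u)) (cong (_+ suc u) (sym (trans (zeros-∷ʳ P x) (+-identityʳ _))))))
  ; has-zero       = ≤-trans has-zero (subst (zeros P ≤_) (sym (zeros-∷ʳ P x)) (m≤m+n _ _))
  ; u+pending≤max  = subst₂ _≤_ (sym length-pending) (sym max≡) bound
  ; pending↓       = subst (λ b → DescendingBelow b (skipped M i ++ S)) (sym max≡) (skipped-descending M i S pending↓)
  ; forbidden-iff  = forbidden-iff′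
  }
  where
  open PrefixState st
  M = maxL P
  x = suc (M + i)
  M<x : M < x
  M<x = s≤s (m≤m+n M i)
  max≡ : maxL (P ∷ʳ x) ≡ x
  max≡ = trans (maxL-∷ʳ P x) (m≤n⇒m⊔n≡n (<⇒≤ M<x))
  length-pending : suc u + length (skipped M i ++ S) ≡ suc (u + (i + length S))
  length-pending = cong (λ l → suc (u + l)) (trans (length-++ (skipped M i)) (cong (_+ length S) (length-skipped M i)))
  bound : suc (u + (i + length S)) ≤ x
  bound = s≤s (subst (_≤ M + i) (trans (+-assoc u (length S) i) (cong (u +_) (+-comm (length S) i))) (+-monoˡ-≤ i u+pending≤max))
  forbidden-iff′ : ∀ v → 0 < v → forbidden (P ∷ʳ x) v ≡ not (v ∈ᵇ (skipped M i ++ S) ∨ (maxL (P ∷ʳ x) <ᵇ v))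
  forbidden-iff′ v 0<v
    rewrite forbidden-∷ʳ P x v has-zero | max≡ | any-++ (v ≡ᵇ_) (skipped M i) S | ∈ᵇ-skipped M i v | forbidden-iff v 0<v
    with <-cmp v x
  ... | tri> _ _ x<v
    rewrite ∈ᵇ-above S v pending↓ (<⇒≤ (<-trans M<x x<v)) | <ᵇ-true (<-trans M<x x<v) | ≡ᵇ-false {x} {v} (<⇒≢ x<v)
          | <ᵇ-true x<v | <ᵇ-false {v} {M} (<⇒≤ (<-trans M<x x<v)) | <ᵇ-false {v} {x} (<⇒≤ x<v) = refl
  ... | tri≈ _ refl _ rewrite ∈ᵇ-above S x pending↓ (<⇒≤ M<x) | <ᵇ-true M<x | ≡ᵇ-refl x | n<ᵇn x = refl
  ... | tri< v<x _ _
    rewrite ≡ᵇ-false {x} {v} (λ x≡v → <⇒≢ v<x (sym x≡v)) | <ᵇ-false {x} {v} (<⇒≤ v<x) | <ᵇ-true v<x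
    with <-cmp M v
  ...   | tri< M<v _ _ rewrite ∈ᵇ-above S v pending↓ (<⇒≤ M<v) | <ᵇ-true M<v = refl
  ...   | tri≈ _ refl _ rewrite ∈ᵇ-above S M pending↓ ≤-refl | n<ᵇn M = refl
  ...   | tri> _ _ v<M rewrite <ᵇ-false {M} {v} (<⇒≤ v<M) with v ∈ᵇ S
  ...     | true  = refl
  ...     | false = refl

z+u∸M<z : ∀ z {u M} → 1 ≤ z → u < M → z + u ∸ M < z
z+u∸M<z (suc z) {u} {M} _ u<M = ≤-<-trans (≤-trans (∸-monoʳ-≤ (suc z + u) u<M) (≤-reflexive (m+n∸n≡m z u))) (n<1+n z)

-- z, u and k stand for the numbers of zero entries, nonzero entries and pending values.
balanced-iff : ∀ z u M k → 1 ≤ z → u + k ≤ M → ((z + u ∸ M) ≡ᵇ z) ≡ (M ≡ᵇ u + k) ∧ (k ≡ᵇ 0)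
balanced-iff z u M (suc k) 1≤z u+k<M =
  trans (≡ᵇ-false (<⇒≢ (z+u∸M<z z 1≤z (≤-trans (s≤s (m≤m+n u k)) (subst (_≤ M) (+-suc u k) u+k<M))))) (sym (∧-zeroʳ _))
balanced-iff z u M zero    1≤z u≤M rewrite +-identityʳ u with m≤n⇒m<n∨m≡n u≤M
... | inj₂ refl rewrite m+n∸n≡m z u | ≡ᵇ-refl z | ≡ᵇ-refl u = refl
... | inj₁ u<M rewrite ≡ᵇ-false {M} {u} (λ M≡u → <⇒≢ u<M (sym M≡u)) = ≡ᵇ-false (<⇒≢ (z+u∸M<z z 1≤z u<M))

-- A prefix whose maximum M differs from u + |S| can never become balanced:
-- some value below M is neither used nor pending.
predicted : ℕ → List ℕ → List ℕ → ℕ → ℕ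
predicted r P S u = if maxL P ≡ᵇ u + length S then Q r (length P ∸ maxL P) (length S) else 0

CompletionCount : ℕ → ℕ → Set
CompletionCount r n = ∀ {P S u} → PrefixState P S u → length P + r ≡ n →
  count (accepts P) (allLists r n) ≡ predicted r P S u

if-∧ : ∀ a b → (if a ∧ b then 1 else 0) ≡ (if a then (if b then 1 else 0) else 0)
if-∧ true  b = refl
if-∧ false b = refl

completions-zero : ∀ n → CompletionCount 0 n
completions-zero n {P} {S} {u} st _ =
  trans (+-identityʳ _) (trans (cong (λ b → if b then 1 else 0) balanced≡) (if-∧ (M ≡ᵇ u + k) (k ≡ᵇ 0)))
  where
  open PrefixState st
  M = maxL P
  k = length S
  balanced≡ : balanced P ≡ (M ≡ᵇ u + k) ∧ (k ≡ᵇ 0)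
  balanced≡ = trans (cong (λ l → (l ∸ M) ≡ᵇ zeros P) length≡zeros+u) (balanced-iff (zeros P) u M k has-zero u+pending≤max)

if-+ : ∀ b (x y : ℕ) → (if b then x else 0) + (if b then y else 0) ≡ (if b then x + y else 0)
if-+ true  x y = refl
if-+ false x y = refl

module CompletionStep {r n : ℕ} (IH : CompletionCount r n) {P S u} (st : PrefixState P S u) (len : length P + suc r ≡ n) where

  open PrefixState st

  M p k D : ℕ
  M = maxL P
  p = length P
  k = length S
  D = p ∸ M

  g : Bool
  g = M ≡ᵇ u + k

  M≤p : M ≤ p
  M≤p = <⇒≤ max<length

  extend : ℕ → ℕ
  extend x = count (λ xs → canExtend P x ∧ accepts (P ∷ʳ x) xs) (allLists r n)

  after : ℕ → ℕ
  after x = count (accepts (P ∷ʳ x)) (allLists r n)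

  extend-blocked : ∀ x → canExtend P x ≡ false → extend x ≡ 0
  extend-blocked x blocked =
    trans (count-∧ˡ (canExtend P x) _ (allLists r n)) (cong (λ b → if b then after x else 0) blocked)

  extend-allowed : ∀ x → canExtend P x ≡ true → extend x ≡ after x
  extend-allowed x allowed =
    trans (count-∧ˡ (canExtend P x) _ (allLists r n)) (cong (λ b → if b then after x else 0) allowed)

  length-∷ʳ+r : ∀ x → length (P ∷ʳ x) + r ≡ n
  length-∷ʳ+r x = trans (cong (_+ r) (length-∷ʳ P x)) (trans (sym (+-suc p r)) len)

  canExtend-positive : ∀ x → 0 < x → x ≤ p → canExtend P x ≡ (x ∈ᵇ S ∨ (M <ᵇ x))
  canExtend-positive x 0<x x≤p rewrite <ᵇ-true (s≤s x≤p) | forbidden-iff x 0<x = not-involutive _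

  extend-low : ∀ x u′ → x ≤ M → canExtend P x ≡ true →
    suc p ≡ (zeros P + (if x ≡ᵇ 0 then 1 else 0)) + u′ → u′ + length (keepBelow x S) ≤ M →
    extend x ≡ (if M ≡ᵇ u′ + length (keepBelow x S) then Q r (suc D) (length (keepBelow x S)) else 0)
  extend-low x u′ x≤M allowed length≡ bound =
    trans (extend-allowed x allowed)
     (trans (IH (state-∷ʳ-low x u′ st x≤M length≡ bound) (length-∷ʳ+r x))
       (cong₂ (λ m d → if m ≡ᵇ u′ + length (keepBelow x S) then Q r d (length (keepBelow x S)) else 0)
              max≡ (trans (cong₂ _∸_ (length-∷ʳ P x) max≡) (+-∸-assoc 1 M≤p))))
    where
    max≡ : maxL (P ∷ʳ x) ≡ M
    max≡ = trans (maxL-∷ʳ P x) (m≥n⇒m⊔n≡m x≤M)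

  extend-zero : extend 0 ≡ (if M ≡ᵇ u + 0 then Q r (suc D) 0 else 0)
  extend-zero =
    trans (extend-low 0 u z≤n (cong not (forbidden-zero P)) length≡ bound)
          (cong (λ S′ → if M ≡ᵇ u + length S′ then Q r (suc D) (length S′) else 0) (keepBelow-zero S))
    where
    length≡ : suc p ≡ (zeros P + 1) + u
    length≡ = trans (cong suc length≡zeros+u) (trans (sym (+-suc (zeros P) u)) (sym (+-assoc (zeros P) 1 u)))
    bound : u + length (keepBelow 0 S) ≤ M
    bound = subst (λ S′ → u + length S′ ≤ M) (sym (keepBelow-zero S))
                  (≤-trans (≤-reflexive (+-identityʳ u)) (≤-trans (m≤m+n u k) u+pending≤max))

  extend-high : ∀ i → i < D → extend (suc (M + i)) ≡ (if g then Q r (D ∸ i) (k + i) else 0)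
  extend-high i i<D =
    trans (extend-allowed x allowed)
     (trans (IH (state-∷ʳ-high i st x≤p) (length-∷ʳ+r x))
       (cong₂ (λ b q → if b then q else 0) guard≡ (cong₂ (Q r) gap≡ pending≡)))
    where
    x = suc (M + i)
    x≤p : x ≤ p
    x≤p = subst (x ≤_) (m+[n∸m]≡n M≤p) (+-monoʳ-< M i<D)
    allowed : canExtend P x ≡ true
    allowed = trans (canExtend-positive x z<s x≤p) (trans (cong (x ∈ᵇ S ∨_) (<ᵇ-true (s≤s (m≤m+n M i)))) (∨-zeroʳ _))
    max≡ : maxL (P ∷ʳ x) ≡ x
    max≡ = trans (maxL-∷ʳ P x) (m≤n⇒m⊔n≡n (m≤n⇒m≤1+n (m≤m+n M i)))
    pending≡ : length (skipped M i ++ S) ≡ k + i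
    pending≡ = trans (length-++ (skipped M i)) (trans (cong (_+ k) (length-skipped M i)) (+-comm i k))
    gap≡ : length (P ∷ʳ x) ∸ maxL (P ∷ʳ x) ≡ D ∸ i
    gap≡ = trans (cong₂ _∸_ (length-∷ʳ P x) max≡) (sym (∸-+-assoc p M i))
    guard≡ : (maxL (P ∷ʳ x) ≡ᵇ suc u + length (skipped M i ++ S)) ≡ g
    guard≡ rewrite max≡ | pending≡ | +-comm M i | sym (+-assoc u k i) | +-comm (u + k) i = +-cancelˡ-≡ᵇ i M (u + k)

  extend-beyond : ∀ i → extend (suc (M + (D + i))) ≡ 0
  extend-beyond i =
    extend-blocked x (cong (_∧ not (forbidden P x)) (<ᵇ-false (s≤s (subst (_≤ M + (D + i)) (m+[n∸m]≡n M≤p) (+-monoʳ-≤ M (m≤m+n D i))))))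
    where
    x = suc (M + (D + i))

  low-sum-empty : S ≡ [] → extend 0 + (∑[ i < M ] extend (suc i)) ≡ (if g then Q r (suc D) (k ∸ 1) else 0)
  low-sum-empty S≡[] =
    trans (cong₂ _+_ extend-zero (∑-zero M (λ i i<M → extend-blocked (suc i) (blocked i i<M))))
          (trans (+-identityʳ _) (cong (λ l → if M ≡ᵇ u + l then Q r (suc D) (l ∸ 1) else 0) (sym (cong length S≡[]))))
    where
    blocked : ∀ i → i < M → canExtend P (suc i) ≡ false
    blocked i i<M = trans (canExtend-positive (suc i) z<s (≤-trans i<M M≤p))
                          (cong₂ _∨_ (cong (suc i ∈ᵇ_) S≡[]) (<ᵇ-false {M} {suc i} i<M))

  -- Only the largest pending value t keeps every value below M used or pending.
  low-sum-nonempty : ∀ t S₁ → S ≡ t ∷ S₁ → extend 0 + (∑[ i < M ] extend (suc i)) ≡ (if g then Q r (suc D) (k ∸ 1) else 0)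
  low-sum-nonempty zero    S₁ S≡ = ⊥-elim (<-irrefl refl (proj₁ (subst (DescendingBelow M) S≡ pending↓)))
  low-sum-nonempty (suc j) S₁ S≡ =
    trans (cong₂ _+_ (trans extend-zero (cong (λ b → if b then Q r (suc D) 0 else 0) (≡ᵇ-false M≢u+0)))
                     (∑-single M (extend ∘ suc) j (<-trans (n<1+n j) t<M) others))
          (trans extend-t (trans (cong (λ m → if M ≡ᵇ m then Q r (suc D) (length S₁) else 0) (sym (+-suc u (length S₁))))
                                 (cong (λ l → if M ≡ᵇ u + l then Q r (suc D) (l ∸ 1) else 0) (sym (cong length S≡)))))
    where
    t = suc j
    t<M : t < M
    t<M = proj₁ (proj₂ (subst (DescendingBelow M) S≡ pending↓))
    S₁↓ : DescendingBelow t S₁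
    S₁↓ = proj₂ (proj₂ (subst (DescendingBelow M) S≡ pending↓))
    bound : suc u + length S₁ ≤ M
    bound = subst (_≤ M) (trans (cong (λ S′ → u + length S′) S≡) (+-suc u (length S₁))) u+pending≤max
    M≢u+0 : M ≢ u + 0
    M≢u+0 M≡ = <-irrefl (sym M≡) (≤-trans (s≤s (≤-trans (≤-reflexive (+-identityʳ u)) (m≤m+n u (length S₁)))) bound)
    length≡ : ∀ x → (x ≡ᵇ 0) ≡ false → suc p ≡ (zeros P + (if x ≡ᵇ 0 then 1 else 0)) + suc u
    length≡ x x≢0 rewrite x≢0 | +-identityʳ (zeros P) = trans (cong suc length≡zeros+u) (sym (+-suc (zeros P) u))
    ∈S : ∀ v → v ∈ᵇ S ≡ (v ≡ᵇ t) ∨ v ∈ᵇ S₁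
    ∈S v = cong (v ∈ᵇ_) S≡
    keepBelow-t : keepBelow t S ≡ S₁
    keepBelow-t = trans (cong (keepBelow t) S≡)
      (trans (cong (λ b → if b then t ∷ keepBelow t S₁ else keepBelow t S₁) (n<ᵇn t)) (keepBelow-all S₁ S₁↓))
    extend-t : extend t ≡ (if M ≡ᵇ suc u + length S₁ then Q r (suc D) (length S₁) else 0)
    extend-t =
      trans (extend-low t (suc u) (<⇒≤ t<M) allowed (length≡ t refl)
                        (subst (λ S′ → suc u + length S′ ≤ M) (sym keepBelow-t) bound))
            (cong (λ S′ → if M ≡ᵇ suc u + length S′ then Q r (suc D) (length S′) else 0) keepBelow-t)
      where
      allowed : canExtend P t ≡ true
      allowed = trans (canExtend-positive t z<s (≤-trans (<⇒≤ t<M) M≤p))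
                      (cong (_∨ (M <ᵇ t)) (trans (∈S t) (cong (_∨ t ∈ᵇ S₁) (≡ᵇ-refl t))))
    others : ∀ i → i < M → i ≢ j → extend (suc i) ≡ 0
    others i i<M i≢j with suc i ∈ᵇ S in x∈ᵇS
    ... | false = extend-blocked x (trans (canExtend-positive x z<s (≤-trans i<M M≤p)) (cong₂ _∨_ x∈ᵇS (<ᵇ-false {M} {x} i<M)))
      where x = suc i
    ... | true  =
      trans (extend-low x (suc u) i<M allowed (length≡ x refl) (<⇒≤ dead))
            (cong (λ b → if b then Q r (suc D) (length (keepBelow x S)) else 0) (≡ᵇ-false (λ M≡ → <-irrefl (sym M≡) dead)))
      where
      x = suc i
      x∈S₁ : x ∈ᵇ S₁ ≡ true
      x∈S₁ = trans (sym (cong (_∨ x ∈ᵇ S₁) (≡ᵇ-false {x} {t} (i≢j ∘ suc-injective)))) (trans (sym (∈S x)) x∈ᵇS)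
      keepBelow-x : keepBelow x S ≡ keepBelow x S₁
      keepBelow-x = trans (cong (keepBelow x) S≡)
        (cong (λ b → if b then t ∷ keepBelow x S₁ else keepBelow x S₁)
              (<ᵇ-false {t} {x} (<⇒≤ (proj₂ (∈ᵇ-bounds S₁ x S₁↓ x∈S₁)))))
      dead : suc u + length (keepBelow x S) < M
      dead = subst (_≤ M) (+-suc (suc u) (length (keepBelow x S)))
               (≤-trans (+-monoʳ-≤ (suc u) (subst (λ S′ → length S′ < length S₁) (sym keepBelow-x)
                                                  (length-keepBelow-∈ x S₁ x∈S₁)))
                        bound)
      allowed : canExtend P x ≡ true
      allowed = trans (canExtend-positive x z<s (≤-trans i<M M≤p)) (cong (_∨ (M <ᵇ x)) x∈ᵇS)

  low-sum : extend 0 + (∑[ i < M ] extend (suc i)) ≡ (if g then Q r (suc D) (k ∸ 1) else 0)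
  low-sum = by-pending S refl
    where
    by-pending : ∀ S′ → S ≡ S′ → extend 0 + (∑[ i < M ] extend (suc i)) ≡ (if g then Q r (suc D) (k ∸ 1) else 0)
    by-pending []       S≡ = low-sum-empty S≡
    by-pending (t ∷ S₁) S≡ = low-sum-nonempty t S₁ S≡

  count-accepts : count (accepts P) (allLists (suc r) n) ≡ predicted (suc r) P S u
  count-accepts = begin
    count (accepts P) (allLists (suc r) n)
      ≡⟨ count-allLists r n (accepts P) ⟩
    sumTo n extend
      ≡⟨ cong (λ m → sumTo m extend) n≡ ⟩
    sumTo (suc M + (D + r)) extend
      ≡⟨ cong (extend 0 +_) (trans (∑-split M (D + r) (extend ∘ suc))
                                   (cong (low +_) (∑-split D r (λ i → extend (suc (M + i)))))) ⟩
    extend 0 + (low + (high + (∑[ i < r ] extend (suc (M + (D + i))))))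
      ≡⟨ cong (λ z → extend 0 + (low + (high + z))) (∑-zero r (λ i _ → extend-beyond i)) ⟩
    extend 0 + (low + (high + 0))
      ≡⟨ trans (cong (λ z → extend 0 + (low + z)) (+-identityʳ high)) (sym (+-assoc (extend 0) low high)) ⟩
    (extend 0 + low) + high
      ≡⟨ cong₂ _+_ low-sum (trans (∑-cong D extend-high) (∑-if D g (λ i → Q r (D ∸ i) (k + i)))) ⟩
    (if g then Q r (suc D) (k ∸ 1) else 0) + (if g then (∑[ i < D ] Q r (D ∸ i) (k + i)) else 0)
      ≡⟨ if-+ g _ _ ⟩
    predicted (suc r) P S u
      ∎
    where
    open ≡-Reasoning
    low high : ℕ
    low = ∑[ i < M ] extend (suc i)
    high = ∑[ i < D ] extend (suc (M + i))
    n≡ : n ≡ suc M + (D + r)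
    n≡ = trans (sym len) (trans (cong (_+ suc r) (sym (m+[n∸m]≡n M≤p))) (lemma M D r))
      where
      lemma : ∀ M D r → M + D + suc r ≡ suc M + (D + r)
      lemma = solve-∀

completions : ∀ r n → CompletionCount r n
completions zero    n = completions-zero n
completions (suc r) n st len = CompletionStep.count-accepts (completions r n) st len

countGood≡rushWalks : ∀ r → countGood (suc r) ≡ rushWalks r 0 1
countGood≡rushWalks r = begin
  countGood (suc r)
    ≡⟨ countGood≡count-accepts (suc r) ⟩
  count (accepts []) (allLists (suc r) (suc r))
    ≡⟨ count-allLists r (suc r) (accepts []) ⟩
  count (accepts (0 ∷ [])) (allLists r (suc r)) + (∑[ x < r ] count (λ _ → false) (allLists r (suc r)))
    ≡⟨ cong₂ _+_ (completions r (suc r) initialState refl) (∑-zero r (λ _ _ → count-false (allLists r (suc r)))) ⟩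
  Q r 1 0 + 0
    ≡⟨ trans (+-identityʳ _) (Q≡rushWalks r 1 0) ⟩
  rushWalks r 0 1
    ∎
  where open ≡-Reasoning

proposition15 : (n : ℕ) → 1 ≤ n → countGood n ≡ countRushed (suc n)
proposition15 (suc r) _ = trans (countGood≡rushWalks r) (sym (countRushed≡rushWalks r))
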